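{- Suppose $M$ is a positroid on $[n]$ which is the direct sum $M_1\oplus M_2$ of two connected positroids $M_1$ and $M_2$ on ground sets $E_1$ and $E_2$ (so $[n]=E_1\sqcup E_2$). Then $E_1$ and $E_2$ are cyclic intervals of $[n]$.
   Context: A matroid on a finite totally ordered set $E=\{e_1<\dots<e_m\}$ is a positroid if there is a real $d\times m$ matrix of rank $d$ with all maximal minors nonnegative whose column matroid is it (column $i$ corresponding to $e_i$); a positroid on $[n]$ uses $1<\dots<n$, and $E_1,E_2$ carry the induced orders. The direct sum of matroids on disjoint ground sets has as bases the unions of bases of the summands. A matroid is connected if it is not a direct sum of two matroids on nonempty ground sets. A cyclic interval of $[n]$ is a set of the form $\{i,i+1,\dots,j\}$ with $i\leq j$ or $\{i,i+1,\dots,n,1,\dots,j\}$ with $j<i$. -}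

module Defs where

open import Level using (Level; _⊔_) renaming (suc to lsuc)
open import Data.Nat using (ℕ; zero; suc)
open import Data.Fin using (Fin; zero; suc; punchIn) renaming (_<_ to _<ᶠ_; _≤_ to _≤ᶠ_)
open import Data.Fin.Subset using (Subset; _∈_; _∉_; _⊆_; _∪_; _∩_; _-_; ⁅_⁆; Nonempty) renaming (⊥ to ∅)
open import Data.Product using (Σ; ∃; ∃₂; _×_; _,_)
open import Data.Sum using (_⊎_)
open import Relation.Nullary using (¬_)
open import Relation.Binary.PropositionalEquality using (_≡_)
open import Relation.Binary.Structures using (IsTotalOrder)
open import Algebra.Bundles using (CommutativeRing)
open import Function.Bundles using (_⇔_)

-- Ordered fields (the paper uses ℝ; agda-stdlib has no reals, so we
-- state the result for an arbitrary ordered field, which includes ℝ).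

record OrderedField (c ℓ : Level) : Set (lsuc (c ⊔ ℓ)) where
  field
    commutativeRing : CommutativeRing c ℓ
  open CommutativeRing commutativeRing public
  field
    _≤_          : Carrier → Carrier → Set ℓ
    isTotalOrder : IsTotalOrder _≈_ _≤_
    0≉1          : ¬ (0# ≈ 1#)
    inverse      : ∀ x → ¬ (x ≈ 0#) → ∃ λ y → x * y ≈ 1#
    +-mono-≤     : ∀ {x y} z → x ≤ y → (x + z) ≤ (y + z)
    *-nonneg     : ∀ {x y} → 0# ≤ x → 0# ≤ y → 0# ≤ (x * y)

module _ {c ℓ} (F : OrderedField c ℓ) where
  open OrderedField F using (Carrier; 0#; 1#; _+_; _*_; -_)

  sumFin : ∀ {m} → (Fin m → Carrier) → Carrier
  sumFin {zero}  f = 0#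
  sumFin {suc m} f = f zero + sumFin (λ i → f (suc i))

  signed : ∀ {m} → Fin m → Carrier → Carrier
  signed zero    x = x
  signed (suc j) x = - signed j x

  det : ∀ {d} → (Fin d → Fin d → Carrier) → Carrier
  det {zero}  A = 1#
  det {suc d} A = sumFin (λ j → signed j (A zero j * det (λ i k → A (suc i) (punchIn j k))))

  minor : ∀ {d n} → (Fin d → Fin n → Carrier) → (Fin d → Fin n) → Carrier
  minor A col = det (λ i k → A i (col k))

-- Matroids on a ground set E ⊆ [n] (given by their bases); the order on E
-- is the one induced from [n].

record Matroid (n : ℕ) : Set₁ where
  field
    ground       : Subset n
    IsBasis      : Subset n → Set
    basis⊆ground : ∀ {B} → IsBasis B → B ⊆ ground
    basis-exists : ∃ IsBasis
    exchange     : ∀ {B B′} → IsBasis B → IsBasis B′ → ∀ {x} → x ∈ B → x ∉ B′ →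
                   ∃ λ y → y ∈ B′ × y ∉ B × IsBasis ((B - x) ∪ ⁅ y ⁆)

open Matroid

StrictlyIncreasing : ∀ {d n} → (Fin d → Fin n) → Set
StrictlyIncreasing col = ∀ i j → i <ᶠ j → col i <ᶠ col j

IsImage : ∀ {d n} → (Fin d → Fin n) → Subset n → Set
IsImage col B = ∀ j → (j ∈ B) ⇔ (∃ λ i → col i ≡ j)

-- Columns outside E are irrelevant.
IsPositroid : ∀ {c ℓ} (F : OrderedField c ℓ) {n} → Matroid n → Set (c ⊔ ℓ)
IsPositroid F {n} M =
  Σ ℕ λ d → Σ (Fin d → Fin n → Carrier) λ A →
      (∃ λ col → StrictlyIncreasing col × (∀ i → col i ∈ ground M) × ¬ (minor F A col ≈ 0#))
    × (∀ col → StrictlyIncreasing col → (∀ i → col i ∈ ground M) → 0# ≤ minor F A col)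
    × (∀ B → IsBasis M B ⇔
         (∃ λ col → StrictlyIncreasing col × (∀ i → col i ∈ ground M) × IsImage col B
                    × ¬ (minor F A col ≈ 0#)))
  where open OrderedField F using (Carrier; 0#; _≈_; _≤_)

IsDirectSum : ∀ {n} → Matroid n → Matroid n → Matroid n → Set
IsDirectSum M N₁ N₂ =
    (ground N₁ ∩ ground N₂ ≡ ∅)
  × (ground M ≡ ground N₁ ∪ ground N₂)
  × (∀ B → IsBasis M B ⇔ (∃₂ λ B₁ B₂ → IsBasis N₁ B₁ × IsBasis N₂ B₂ × B ≡ B₁ ∪ B₂))

Connected : ∀ {n} → Matroid n → Set₁
Connected M = ¬ (∃₂ λ N₁ N₂ → Nonempty (ground N₁) × Nonempty (ground N₂) × IsDirectSum M N₁ N₂)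

CyclicInterval : ∀ {n} → Subset n → Set
CyclicInterval {n} E = ∃₂ λ (i j : Fin n) → ∀ k → (k ∈ E) ⇔
  ((i ≤ᶠ j × i ≤ᶠ k × k ≤ᶠ j) ⊎ (j <ᶠ i × (i ≤ᶠ k ⊎ k ≤ᶠ j)))

-- If E₁ and E₂ interleave as a < b < c < d with a, c ∈ E₁ and b, d ∈ E₂, connectivity of the summands yields
-- basis exchanges p ↦ r in M₁ and q ↦ s in M₂ with p < q < r < s: a connected matroid with no exchange across a
-- set X would split as a direct sum along X. If S is the part the two exchanged bases share, S ∪ {q, r} and
-- S ∪ {p, s} are bases of M = M₁ ⊕ M₂ but S ∪ {p, r} is not, contradicting the three-term Plücker relation
--   Δ(Spr) Δ(Sqs) = Δ(Sqr) Δ(Sps) + Δ(Spq) Δ(Srs)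
-- between nonnegative maximal minors. Two complementary sets without such an interleaving are cyclic intervals.
module Submission where

open import Defs
open import Data.Nat using (ℕ)
open import Data.Product using (_×_; _,_)
open import Data.Fin.Subset using (⊤; Nonempty)
open import Relation.Binary.PropositionalEquality using (_≡_)

module StrictlyIncreasingMaps where

  open import Data.Nat as ℕ using (ℕ; zero; suc; z≤n; s≤s)
  import Data.Nat.Properties as ℕ
  open import Data.Fin using (Fin; zero; suc; toℕ; punchIn; punchOut) renaming (_<_ to _<ᶠ_; _≤_ to _≤ᶠ_)
  open import Data.Fin.Properties using (toℕ-injective; punchInᵢ≢i; punchIn-punchOut)
  open import Data.Fin.Subset using (Subset; inside; outside)
  open import Data.Vec using (_∷_; []; here; there)
  open import Data.Product using (∃; ∃₂; _×_; _,_; proj₁; proj₂)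
  open import Data.Empty using (⊥-elim)
  open import Relation.Nullary using (yes; no)
  open import Relation.Binary.Definitions using (tri<; tri≈; tri>)
  open import Relation.Binary.PropositionalEquality
  open import Function using (_∘_; id)
  open import Function.Bundles using (Equivalence; mk⇔)

  _∈Im_ : ∀ {a n} → Fin n → (Fin a → Fin n) → Set
  x ∈Im f = ∃ λ i → f i ≡ x

  _⊆Im_ : ∀ {a b n} → (Fin a → Fin n) → (Fin b → Fin n) → Set
  f ⊆Im g = ∀ {x} → x ∈Im f → x ∈Im g

  isImage⇒⊆Im : ∀ {a b n} {f : Fin a → Fin n} {g : Fin b → Fin n} {B} → IsImage f B → IsImage g B → f ⊆Im g
  isImage⇒⊆Im imf img {x} = Equivalence.to (img x) ∘ Equivalence.from (imf x)

  module _ {a n} {f : Fin a → Fin n} (f↑ : StrictlyIncreasing f) where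

    strictlyIncreasing⇒monotone : ∀ i j → i ≤ᶠ j → f i ≤ᶠ f j
    strictlyIncreasing⇒monotone i j i≤j with toℕ i ℕ.≟ toℕ j
    ... | yes i≡j = ℕ.≤-reflexive (cong (toℕ ∘ f) (toℕ-injective i≡j))
    ... | no i≢j = ℕ.<⇒≤ (f↑ i j (ℕ.≤∧≢⇒< i≤j i≢j))

    strictlyIncreasing⇒injective : ∀ i j → f i ≡ f j → i ≡ j
    strictlyIncreasing⇒injective i j fi≡fj with ℕ.<-cmp (toℕ i) (toℕ j)
    ... | tri< i<j _ _ = ⊥-elim (ℕ.<-irrefl (cong toℕ fi≡fj) (f↑ i j i<j))
    ... | tri≈ _ i≡j _ = toℕ-injective i≡j
    ... | tri> _ _ j<i = ⊥-elim (ℕ.<-irrefl (cong toℕ (sym fi≡fj)) (f↑ j i j<i))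

    strictlyIncreasing-reflects-< : ∀ i j → f i <ᶠ f j → i <ᶠ j
    strictlyIncreasing-reflects-< i j fi<fj with ℕ.<-cmp (toℕ i) (toℕ j)
    ... | tri< i<j _ _ = i<j
    ... | tri≈ _ i≡j _ = ⊥-elim (ℕ.<-irrefl (cong (toℕ ∘ f) (toℕ-injective i≡j)) fi<fj)
    ... | tri> _ _ j<i = ⊥-elim (ℕ.<-asym fi<fj (f↑ j i j<i))

  id-strictlyIncreasing : ∀ {n} → StrictlyIncreasing {n} id
  id-strictlyIncreasing _ _ i<j = i<j

  punchIn-strictlyIncreasing : ∀ {m} (z : Fin (suc m)) → StrictlyIncreasing (punchIn z)
  punchIn-strictlyIncreasing zero i j i<j = s≤s i<j
  punchIn-strictlyIncreasing (suc z) zero (suc j) _ = s≤s z≤n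
  punchIn-strictlyIncreasing (suc z) (suc i) (suc j) (s≤s i<j) = s≤s (punchIn-strictlyIncreasing z i j i<j)

  strictlyIncreasing-∘ : ∀ {a b n} {f : Fin b → Fin n} {g : Fin a → Fin b} →
                         StrictlyIncreasing f → StrictlyIncreasing g → StrictlyIncreasing (f ∘ g)
  strictlyIncreasing-∘ f↑ g↑ i j i<j = f↑ _ _ (g↑ i j i<j)

  ∈Im-∘punchIn⁺ : ∀ {a n} {f : Fin (suc a) → Fin n} z {x} → x ∈Im f → x ≢ f z → x ∈Im (f ∘ punchIn z)
  ∈Im-∘punchIn⁺ {f = f} z (i , fi≡x) x≢fz =
    let z≢i = λ z≡i → x≢fz (trans (sym fi≡x) (cong f (sym z≡i)))
    in _ , trans (cong f (punchIn-punchOut z≢i)) fi≡x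

  ∈Im-∘punchIn⁻ : ∀ {a n} {f : Fin (suc a) → Fin n} → StrictlyIncreasing f →
                  ∀ z {x} → x ∈Im (f ∘ punchIn z) → x ∈Im f × x ≢ f z
  ∈Im-∘punchIn⁻ f↑ z (k , fk≡x) =
    (punchIn z k , fk≡x) ,
    λ x≡fz → punchInᵢ≢i z k (strictlyIncreasing⇒injective f↑ _ _ (trans fk≡x x≡fz))

  -- The two lengths may differ, so agreement is stated for indices with equal toℕ.
  private
    sameImage⇒agree : ∀ {a b n} (f : Fin a → Fin n) (g : Fin b → Fin n) →
                      StrictlyIncreasing f → StrictlyIncreasing g → f ⊆Im g → g ⊆Im f →
                      a ≡ b × (∀ i j → toℕ i ≡ toℕ j → f i ≡ g j)
    sameImage⇒agree {zero} {zero} f g _ _ _ _ = refl , λ ()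
    sameImage⇒agree {zero} {suc b} f g _ _ _ g⊆f with g⊆f (zero , refl)
    ... | () , _
    sameImage⇒agree {suc a} {zero} f g _ _ f⊆g _ with f⊆g (zero , refl)
    ... | () , _
    sameImage⇒agree {suc a} {suc b} {n} f g f↑ g↑ f⊆g g⊆f =
      cong suc (proj₁ tails) , λ { zero zero _ → heads ; (suc i) (suc j) i≡j → proj₂ tails i j (ℕ.suc-injective i≡j) }
      where
      heads : f zero ≡ g zero
      heads with f⊆g (zero , refl) | g⊆f (zero , refl)
      ... | j , gj≡f0 | i , fi≡g0 = toℕ-injective (ℕ.≤-antisym
        (subst (λ z → toℕ (f zero) ℕ.≤ toℕ z) fi≡g0 (strictlyIncreasing⇒monotone f↑ zero i z≤n))
        (subst (λ z → toℕ (g zero) ℕ.≤ toℕ z) gj≡f0 (strictlyIncreasing⇒monotone g↑ zero j z≤n)))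
      tail⊆ : ∀ {a′ b′} (f′ : Fin (suc a′) → Fin n) (g′ : Fin (suc b′) → Fin n) → StrictlyIncreasing f′ →
              f′ zero ≡ g′ zero → f′ ⊆Im g′ → (f′ ∘ suc) ⊆Im (g′ ∘ suc)
      tail⊆ f′ g′ f′↑ heads′ f′⊆g′ (i , fi≡x) with f′⊆g′ (suc i , fi≡x)
      ... | suc j , gj≡x = j , gj≡x
      ... | zero , g0≡x = ⊥-elim (ℕ.<-irrefl (cong toℕ (trans heads′ (trans g0≡x (sym fi≡x))))
                                              (f′↑ zero (suc i) (s≤s z≤n)))
      tails : a ≡ b × (∀ i j → toℕ i ≡ toℕ j → f (suc i) ≡ g (suc j))
      tails = sameImage⇒agree (f ∘ suc) (g ∘ suc)
        (λ i j i<j → f↑ (suc i) (suc j) (s≤s i<j)) (λ i j i<j → g↑ (suc i) (suc j) (s≤s i<j))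
        (tail⊆ f g f↑ heads f⊆g) (tail⊆ g f g↑ (sym heads) g⊆f)

  sameImage⇒sameLength : ∀ {a b n} {f : Fin a → Fin n} {g : Fin b → Fin n} → StrictlyIncreasing f → StrictlyIncreasing g →
                         f ⊆Im g → g ⊆Im f → a ≡ b
  sameImage⇒sameLength {f = f} {g} f↑ g↑ f⊆g g⊆f = proj₁ (sameImage⇒agree f g f↑ g↑ f⊆g g⊆f)

  sameImage⇒≗ : ∀ {a n} {f g : Fin a → Fin n} → StrictlyIncreasing f → StrictlyIncreasing g →
                f ⊆Im g → g ⊆Im f → ∀ i → f i ≡ g i
  sameImage⇒≗ {f = f} {g} f↑ g↑ f⊆g g⊆f i = proj₂ (sameImage⇒agree f g f↑ g↑ f⊆g g⊆f) i i refl

  enumerate : ∀ {n} (W : Subset n) → ∃₂ λ a (f : Fin a → Fin n) → StrictlyIncreasing f × IsImage f W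
  enumerate [] = 0 , (λ ()) , (λ ()) , λ ()
  enumerate (outside ∷ W) with enumerate W
  ... | a , f , f↑ , imf = a , suc ∘ f , (λ i j i<j → s≤s (f↑ i j i<j)) , im
    where
    im : IsImage (suc ∘ f) (outside ∷ W)
    im zero = mk⇔ (λ ()) (λ { (_ , ()) })
    im (suc x) = mk⇔ (λ { (there x∈W) → let i , fi≡x = Equivalence.to (imf x) x∈W in i , cong suc fi≡x })
                     (λ { (i , refl) → there (Equivalence.from (imf x) (i , refl)) })
  enumerate (inside ∷ W) with enumerate W
  ... | a , f , f↑ , imf = suc a , g , g↑ , im
    where
    g : Fin (suc a) → Fin _
    g zero = zero
    g (suc i) = suc (f i)
    g↑ : StrictlyIncreasing g
    g↑ zero (suc j) _ = s≤s z≤n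
    g↑ (suc i) (suc j) (s≤s i<j) = s≤s (f↑ i j i<j)
    im : IsImage g (inside ∷ W)
    im zero = mk⇔ (λ _ → zero , refl) (λ _ → here)
    im (suc x) = mk⇔ (λ { (there x∈W) → let i , fi≡x = Equivalence.to (imf x) x∈W in suc i , cong suc fi≡x })
                     (λ { (suc i , refl) → there (Equivalence.from (imf x) (i , refl)) })

  -- The positions other than X and Y, in increasing order.
  skip₂ : ∀ {k} (Y X : Fin (suc (suc k))) → Y ≢ X → Fin k → Fin (suc (suc k))
  skip₂ Y X Y≢X = punchIn Y ∘ punchIn (punchOut Y≢X)

  skip₂-strictlyIncreasing : ∀ {k} (Y X : Fin (suc (suc k))) (Y≢X : Y ≢ X) → StrictlyIncreasing (skip₂ Y X Y≢X)
  skip₂-strictlyIncreasing Y X Y≢X =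
    strictlyIncreasing-∘ (punchIn-strictlyIncreasing Y) (punchIn-strictlyIncreasing (punchOut Y≢X))

  module _ {k n} {f : Fin (suc (suc k)) → Fin n} (f↑ : StrictlyIncreasing f) (Y X : Fin (suc (suc k))) (Y≢X : Y ≢ X) where

    ∈Im-skip₂⁻ : ∀ {x} → x ∈Im (f ∘ skip₂ Y X Y≢X) → x ∈Im f × x ≢ f X × x ≢ f Y
    ∈Im-skip₂⁻ x∈ with ∈Im-∘punchIn⁻ (strictlyIncreasing-∘ f↑ (punchIn-strictlyIncreasing Y)) (punchOut Y≢X) x∈
    ... | x∈′ , x≢fX′ with ∈Im-∘punchIn⁻ f↑ Y x∈′
    ... | x∈f , x≢fY = x∈f , (λ x≡fX → x≢fX′ (trans x≡fX (sym (cong f (punchIn-punchOut Y≢X))))) , x≢fY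

    ∈Im-skip₂⁺ : ∀ {x} → x ∈Im f → x ≢ f X → x ≢ f Y → x ∈Im (f ∘ skip₂ Y X Y≢X)
    ∈Im-skip₂⁺ x∈f x≢fX x≢fY =
      ∈Im-∘punchIn⁺ (punchOut Y≢X) (∈Im-∘punchIn⁺ Y x∈f x≢fY) (λ x≡ → x≢fX (trans x≡ (cong f (punchIn-punchOut Y≢X))))

module AdjacentTranspositions where

  open import Data.Nat using (zero; suc; s≤s; _<_)
  open import Data.Fin using (Fin; zero; suc; toℕ; punchIn; punchOut; inject₁) renaming (_<_ to _<ᶠ_)
  open import Data.Product using (∃; _,_)
  open import Data.Empty using (⊥-elim)
  open import Relation.Binary.PropositionalEquality
  open import Function using (_∘_)

  swapAdjacent : ∀ {m} → Fin m → Fin (suc m) → Fin (suc m)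
  swapAdjacent zero zero = suc zero
  swapAdjacent zero (suc zero) = zero
  swapAdjacent zero (suc (suc x)) = suc (suc x)
  swapAdjacent (suc k) zero = zero
  swapAdjacent (suc k) (suc x) = suc (swapAdjacent k x)

  swapAdjacent-inject₁ : ∀ {m} (k : Fin m) → swapAdjacent k (inject₁ k) ≡ suc k
  swapAdjacent-inject₁ zero = refl
  swapAdjacent-inject₁ (suc k) = cong suc (swapAdjacent-inject₁ k)

  swapAdjacent-suc : ∀ {m} (k : Fin m) → swapAdjacent k (suc k) ≡ inject₁ k
  swapAdjacent-suc zero = refl
  swapAdjacent-suc (suc k) = cong suc (swapAdjacent-suc k)

  swapAdjacent-fix : ∀ {m} (k : Fin m) j → j ≢ inject₁ k → j ≢ suc k → swapAdjacent k j ≡ j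
  swapAdjacent-fix zero zero j≢k _ = ⊥-elim (j≢k refl)
  swapAdjacent-fix zero (suc zero) _ j≢k+1 = ⊥-elim (j≢k+1 refl)
  swapAdjacent-fix zero (suc (suc j)) _ _ = refl
  swapAdjacent-fix (suc k) zero _ _ = refl
  swapAdjacent-fix (suc k) (suc j) j≢k j≢k+1 = cong suc (swapAdjacent-fix k j (j≢k ∘ cong suc) (j≢k+1 ∘ cong suc))

  swapAdjacent-punchIn-inject₁ : ∀ {m} (k : Fin (suc m)) l →
                                 swapAdjacent k (punchIn (inject₁ k) l) ≡ punchIn (suc k) l
  swapAdjacent-punchIn-inject₁ zero zero = refl
  swapAdjacent-punchIn-inject₁ zero (suc l) = refl
  swapAdjacent-punchIn-inject₁ {suc m} (suc k) zero = refl
  swapAdjacent-punchIn-inject₁ {suc m} (suc k) (suc l) = cong suc (swapAdjacent-punchIn-inject₁ k l)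

  swapAdjacent-punchIn-suc : ∀ {m} (k : Fin (suc m)) l →
                             swapAdjacent k (punchIn (suc k) l) ≡ punchIn (inject₁ k) l
  swapAdjacent-punchIn-suc zero zero = refl
  swapAdjacent-punchIn-suc zero (suc l) = refl
  swapAdjacent-punchIn-suc {suc m} (suc k) zero = refl
  swapAdjacent-punchIn-suc {suc m} (suc k) (suc l) = cong suc (swapAdjacent-punchIn-suc k l)

  swapAdjacent-punchIn : ∀ {m} (k : Fin (suc m)) (j : Fin (suc (suc m))) → j ≢ inject₁ k → j ≢ suc k →
                         ∃ λ (k′ : Fin m) → ∀ l → swapAdjacent k (punchIn j l) ≡ punchIn j (swapAdjacent k′ l)
  swapAdjacent-punchIn zero zero j≢k _ = ⊥-elim (j≢k refl)
  swapAdjacent-punchIn zero (suc zero) _ j≢k+1 = ⊥-elim (j≢k+1 refl)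
  swapAdjacent-punchIn {zero} zero (suc (suc ())) _ _
  swapAdjacent-punchIn {suc m} zero (suc (suc j)) _ _ = zero , λ { zero → refl ; (suc zero) → refl ; (suc (suc l)) → refl }
  swapAdjacent-punchIn {suc m} (suc k) zero _ _ = k , λ l → refl
  swapAdjacent-punchIn {suc m} (suc k) (suc j) j≢k j≢k+1
    with swapAdjacent-punchIn k j (j≢k ∘ cong suc) (j≢k+1 ∘ cong suc)
  ... | k′ , commute = suc k′ , λ { zero → refl ; (suc l) → cong suc (commute l) }

  toℕ-punchOut-< : ∀ {m} {i j : Fin (suc m)} (i≢j : i ≢ j) → j <ᶠ i → toℕ (punchOut i≢j) ≡ toℕ j
  toℕ-punchOut-< {m} {zero} i≢j ()
  toℕ-punchOut-< {suc m} {suc i} {zero} i≢j j<i = refl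
  toℕ-punchOut-< {suc m} {suc i} {suc j} i≢j (s≤s j<i) = cong suc (toℕ-punchOut-< (i≢j ∘ cong suc) j<i)

  toℕ-punchOut-> : ∀ {m} {i j : Fin (suc m)} (i≢j : i ≢ j) → i <ᶠ j → suc (toℕ (punchOut i≢j)) ≡ toℕ j
  toℕ-punchOut-> {m} {zero} {zero} i≢j ()
  toℕ-punchOut-> {m} {zero} {suc j} i≢j i<j = refl
  toℕ-punchOut-> {suc m} {suc i} {suc j} i≢j (s≤s i<j) = cong suc (toℕ-punchOut-> (i≢j ∘ cong suc) i<j)
  toℕ-punchOut-> {zero} {suc ()} i≢j i<j

  punchOut-< : ∀ {m} {i j k : Fin (suc m)} (i≢j : i ≢ j) (i≢k : i ≢ k) → j <ᶠ i → k <ᶠ i → j <ᶠ k →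
               punchOut i≢j <ᶠ punchOut i≢k
  punchOut-< i≢j i≢k j<i k<i = subst₂ _<_ (sym (toℕ-punchOut-< i≢j j<i)) (sym (toℕ-punchOut-< i≢k k<i))

module OrderedFieldProperties {c ℓ} (F : OrderedField c ℓ) where

  open import Data.Nat using (ℕ; zero; suc)
  open import Data.Fin using (Fin; zero; suc; toℕ; punchIn; punchOut; inject₁)
  open import Data.Fin.Properties using (punchInᵢ≢i; punchIn-injective; punchIn-punchOut)
  open import Data.Product using (_,_)
  open import Data.Sum using (inj₁; inj₂)
  open import Relation.Nullary using (¬_)
  import Relation.Binary.PropositionalEquality as ≡
  open ≡ using (_≡_; _≢_)
  open import Function using (_∘_)
  open import Relation.Binary.Structures using (IsTotalOrder)
  import Algebra.Properties.CommutativeSemigroup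

  open OrderedField F public hiding (zero)
  open import Algebra.Properties.Ring ring public
    using (-‿distribˡ-*; -‿distribʳ-*; -‿involutive; -‿anti-homo-+; -0#≈0#)
  open import Relation.Binary.Reasoning.Setoid setoid public
  open IsTotalOrder isTotalOrder using (total; antisym; ≤-respˡ-≈; ≤-respʳ-≈)
  module +-CS = Algebra.Properties.CommutativeSemigroup +-commutativeSemigroup
  module *-CS = Algebra.Properties.CommutativeSemigroup *-commutativeSemigroup

  ∑ : ∀ {m} → (Fin m → Carrier) → Carrier
  ∑ = sumFin F

  ∑-cong : ∀ {m} {f g : Fin m → Carrier} → (∀ i → f i ≈ g i) → ∑ f ≈ ∑ g
  ∑-cong {zero} f≈g = refl
  ∑-cong {suc m} f≈g = +-cong (f≈g zero) (∑-cong (f≈g ∘ suc))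

  ∑-zero : ∀ {m} {f : Fin m → Carrier} → (∀ i → f i ≈ 0#) → ∑ f ≈ 0#
  ∑-zero {zero} _ = refl
  ∑-zero {suc m} f≈0 = trans (+-cong (f≈0 zero) (∑-zero (f≈0 ∘ suc))) (+-identityˡ 0#)

  ∑-distrib-+ : ∀ {m} (f g : Fin m → Carrier) → ∑ (λ i → f i + g i) ≈ ∑ f + ∑ g
  ∑-distrib-+ {zero} f g = sym (+-identityˡ 0#)
  ∑-distrib-+ {suc m} f g = trans (+-congˡ (∑-distrib-+ (f ∘ suc) (g ∘ suc))) (+-CS.interchange _ _ _ _)

  *-distribˡ-∑ : ∀ {m} a (f : Fin m → Carrier) → a * ∑ f ≈ ∑ (λ i → a * f i)
  *-distribˡ-∑ {zero} a f = zeroʳ a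
  *-distribˡ-∑ {suc m} a f = trans (distribˡ a _ _) (+-congˡ (*-distribˡ-∑ a (f ∘ suc)))

  *-distribʳ-∑ : ∀ {m} a (f : Fin m → Carrier) → ∑ f * a ≈ ∑ (λ i → f i * a)
  *-distribʳ-∑ a f = trans (*-comm _ a) (trans (*-distribˡ-∑ a f) (∑-cong (λ i → *-comm a (f i))))

  -‿distrib-+ : ∀ x y → - (x + y) ≈ - x + - y
  -‿distrib-+ x y = trans (-‿anti-homo-+ x y) (+-comm _ _)

  -‿distrib-∑ : ∀ {m} (f : Fin m → Carrier) → - ∑ f ≈ ∑ (λ i → - f i)
  -‿distrib-∑ {zero} f = -0#≈0#
  -‿distrib-∑ {suc m} f = trans (-‿distrib-+ _ _) (+-congˡ (-‿distrib-∑ (f ∘ suc)))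

  ∑-comm : ∀ {m k} (f : Fin m → Fin k → Carrier) → ∑ (λ i → ∑ (f i)) ≈ ∑ (λ j → ∑ (λ i → f i j))
  ∑-comm {zero} {k} f = sym (∑-zero {k} (λ _ → refl))
  ∑-comm {suc m} f = trans (+-congˡ (∑-comm (f ∘ suc))) (sym (∑-distrib-+ (f zero) _))

  ∑-remove : ∀ {m} (j : Fin (suc m)) (f : Fin (suc m) → Carrier) → ∑ f ≈ f j + ∑ (f ∘ punchIn j)
  ∑-remove zero f = refl
  ∑-remove {suc m} (suc j) f = trans (+-congˡ (∑-remove j (f ∘ suc))) (+-CS.x∙yz≈y∙xz _ _ _)

  ∑-single : ∀ {m} (a : Fin m) (f : Fin m → Carrier) → (∀ t → t ≢ a → f t ≈ 0#) → ∑ f ≈ f a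
  ∑-single {suc m} a f f≈0 = begin
    ∑ f                      ≈⟨ ∑-remove a f ⟩
    f a + ∑ (f ∘ punchIn a)  ≈⟨ +-congˡ (∑-zero (λ t → f≈0 (punchIn a t) (punchInᵢ≢i a t))) ⟩
    f a + 0#                 ≈⟨ +-identityʳ _ ⟩
    f a                      ∎

  private
    punchIn-≢ : ∀ {m} {a b : Fin (suc m)} (a≢b : a ≢ b) t → t ≢ punchOut a≢b → punchIn a t ≢ b
    punchIn-≢ a≢b t t≢b′ e = t≢b′ (punchIn-injective _ t _ (≡.trans e (≡.sym (punchIn-punchOut a≢b))))

  ∑-pair : ∀ {m} (a b : Fin m) → a ≢ b → (f : Fin m → Carrier) →
           (∀ t → t ≢ a → t ≢ b → f t ≈ 0#) → ∑ f ≈ f a + f b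
  ∑-pair {suc m} a b a≢b f f≈0 = begin
    ∑ f                      ≈⟨ ∑-remove a f ⟩
    f a + ∑ (f ∘ punchIn a)  ≈⟨ +-congˡ (∑-single _ (f ∘ punchIn a) λ t t≢b′ →
                                           f≈0 _ (punchInᵢ≢i a t) (punchIn-≢ a≢b t t≢b′)) ⟩
    f a + f (punchIn a (punchOut a≢b)) ≡⟨ ≡.cong (λ x → f a + f x) (punchIn-punchOut a≢b) ⟩
    f a + f b                ∎

  ∑-triple : ∀ {m} (a b c : Fin m) → a ≢ b → a ≢ c → b ≢ c → (f : Fin m → Carrier) →
             (∀ t → t ≢ a → t ≢ b → t ≢ c → f t ≈ 0#) → ∑ f ≈ f a + (f b + f c)
  ∑-triple {suc m} a b c a≢b a≢c b≢c f f≈0 = begin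
    ∑ f                      ≈⟨ ∑-remove a f ⟩
    f a + ∑ (f ∘ punchIn a)  ≈⟨ +-congˡ (∑-pair _ _ b′≢c′ (f ∘ punchIn a) λ t t≢b′ t≢c′ →
                                           f≈0 _ (punchInᵢ≢i a t) (punchIn-≢ a≢b t t≢b′) (punchIn-≢ a≢c t t≢c′)) ⟩
    f a + (f (punchIn a (punchOut a≢b)) + f (punchIn a (punchOut a≢c)))
      ≡⟨ ≡.cong₂ (λ x y → f a + (f x + f y)) (punchIn-punchOut a≢b) (punchIn-punchOut a≢c) ⟩
    f a + (f b + f c)        ∎
    where
    b′≢c′ : punchOut a≢b ≢ punchOut a≢c
    b′≢c′ e = b≢c (≡.trans (≡.sym (punchIn-punchOut a≢b)) (≡.trans (≡.cong (punchIn a) e) (punchIn-punchOut a≢c)))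

  sign : ℕ → Carrier
  sign zero = 1#
  sign (suc k) = - sign k

  -‿*-distrib : ∀ x y → - x * - y ≈ x * y
  -‿*-distrib x y = trans (sym (-‿distribˡ-* x (- y))) (trans (-‿cong (sym (-‿distribʳ-* x y))) (-‿involutive _))

  sign*sign : ∀ k → sign k * sign k ≈ 1#
  sign*sign zero = *-identityˡ 1#
  sign*sign (suc k) = trans (-‿*-distrib _ _) (sign*sign k)

  sign-cancel : ∀ a b x y → a ≡ b → sign a * (x * (sign b * y)) ≈ x * y
  sign-cancel a .a x y ≡.refl = begin
    sign a * (x * (sign a * y))  ≈⟨ *-congˡ (*-CS.x∙yz≈y∙xz x _ y) ⟩
    sign a * (sign a * (x * y))  ≈⟨ sym (*-assoc _ _ _) ⟩
    (sign a * sign a) * (x * y)  ≈⟨ *-congʳ (sign*sign a) ⟩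
    1# * (x * y)                 ≈⟨ *-identityˡ _ ⟩
    x * y                        ∎

  sign-cancel-suc : ∀ a b x y → a ≡ suc b → sign a * (x * (sign b * y)) ≈ - (x * y)
  sign-cancel-suc a b x y ≡.refl = trans (sym (-‿distribˡ-* _ _)) (-‿cong (sign-cancel b b x y ≡.refl))

  sign-cancel-suc-suc : ∀ a b x y → a ≡ suc (suc b) → sign a * (x * (sign b * y)) ≈ x * y
  sign-cancel-suc-suc a b x y ≡.refl = trans (*-congʳ (-‿involutive _)) (sign-cancel b b x y ≡.refl)

  signed≈sign* : ∀ {m} (j : Fin m) x → signed F j x ≈ sign (toℕ j) * x
  signed≈sign* zero x = sym (*-identityˡ x)
  signed≈sign* (suc j) x = trans (-‿cong (signed≈sign* j x)) (-‿distribˡ-* _ _)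

  signed-cong : ∀ {m} (j : Fin m) {x y} → x ≈ y → signed F j x ≈ signed F j y
  signed-cong zero x≈y = x≈y
  signed-cong (suc j) x≈y = -‿cong (signed-cong j x≈y)

  signed-‿ : ∀ {m} (j : Fin m) x → signed F j (- x) ≈ - signed F j x
  signed-‿ zero x = refl
  signed-‿ (suc j) x = -‿cong (signed-‿ j x)

  signed-inject₁ : ∀ {m} (j : Fin m) x → signed F (inject₁ j) x ≡ signed F j x
  signed-inject₁ zero x = ≡.refl
  signed-inject₁ (suc j) x = ≡.cong -_ (signed-inject₁ j x)

  signed-*ˡ : ∀ {m} (j : Fin m) a x → signed F j (a * x) ≈ a * signed F j x
  signed-*ˡ zero a x = refl
  signed-*ˡ (suc j) a x = trans (-‿cong (signed-*ˡ j a x)) (-‿distribʳ-* a _)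

  signed-*ʳ : ∀ {m} (j : Fin m) x a → signed F j (x * a) ≈ signed F j x * a
  signed-*ʳ j x a = trans (signed-cong j (*-comm x a)) (trans (signed-*ˡ j a x) (*-comm a _))

  signed-∑ : ∀ {m k} (j : Fin m) (f : Fin k → Carrier) → signed F j (∑ f) ≈ ∑ (λ i → signed F j (f i))
  signed-∑ zero f = refl
  signed-∑ (suc j) f = trans (-‿cong (signed-∑ j f)) (-‿distrib-∑ (λ i → signed F j (f i)))

  ≤-resp-≈ : ∀ {x y x′ y′} → x ≈ x′ → y ≈ y′ → x ≤ y → x′ ≤ y′
  ≤-resp-≈ x≈x′ y≈y′ x≤y = ≤-respʳ-≈ y≈y′ (≤-respˡ-≈ x≈x′ x≤y)

  0≤1 : 0# ≤ 1#
  0≤1 with total 0# 1#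
  ... | inj₁ 0≤1 = 0≤1
  ... | inj₂ 1≤0 = ≤-resp-≈ refl (trans (-‿*-distrib 1# 1#) (*-identityˡ 1#)) (*-nonneg 0≤-1 0≤-1)
    where
    0≤-1 : 0# ≤ (- 1#)
    0≤-1 = ≤-resp-≈ (-‿inverseʳ 1#) (+-identityˡ _) (+-mono-≤ (- 1#) 1≤0)

  1+1≉0 : ¬ (1# + 1# ≈ 0#)
  1+1≉0 2≈0 = 0≉1 (antisym 0≤1 (≤-resp-≈ (+-identityˡ 1#) 2≈0 (+-mono-≤ 1# 0≤1)))

  x*y≉0 : ∀ {x y} → ¬ (x ≈ 0#) → ¬ (y ≈ 0#) → ¬ (x * y ≈ 0#)
  x*y≉0 {x} {y} x≉0 y≉0 xy≈0 with inverse x x≉0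
  ... | x⁻¹ , xx⁻¹≈1 = y≉0 (begin
    y              ≈⟨ sym (*-identityˡ y) ⟩
    1# * y         ≈⟨ *-congʳ (trans (sym xx⁻¹≈1) (*-comm x x⁻¹)) ⟩
    (x⁻¹ * x) * y  ≈⟨ *-assoc x⁻¹ x y ⟩
    x⁻¹ * (x * y)  ≈⟨ *-congˡ xy≈0 ⟩
    x⁻¹ * 0#       ≈⟨ zeroʳ x⁻¹ ⟩
    0#             ∎)

  x≈-y⇒y≈-x : ∀ {x y} → x ≈ - y → y ≈ - x
  x≈-y⇒y≈-x {x} {y} x≈-y = trans (sym (-‿involutive y)) (-‿cong (sym x≈-y))

  -- 1 + 1 is invertible because the order forces 0 < 1 < 1 + 1.
  x≈-x⇒x≈0 : ∀ {x} → x ≈ - x → x ≈ 0#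
  x≈-x⇒x≈0 {x} x≈-x with inverse (1# + 1#) 1+1≉0
  ... | h , 2h≈1 = begin
    x                    ≈⟨ sym (*-identityˡ x) ⟩
    1# * x               ≈⟨ *-congʳ (trans (sym 2h≈1) (*-comm _ h)) ⟩
    (h * (1# + 1#)) * x  ≈⟨ *-assoc h _ x ⟩
    h * ((1# + 1#) * x)  ≈⟨ *-congˡ (trans (distribʳ x 1# 1#) (+-cong (*-identityˡ x) (*-identityˡ x))) ⟩
    h * (x + x)          ≈⟨ *-congˡ (trans (+-congˡ x≈-x) (-‿inverseʳ x)) ⟩
    h * 0#               ≈⟨ zeroʳ h ⟩
    0#                   ∎

  nonneg+nonneg≈0⇒≈0 : ∀ {u v} → 0# ≤ u → 0# ≤ v → u + v ≈ 0# → u ≈ 0#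
  nonneg+nonneg≈0⇒≈0 {u} {v} 0≤u 0≤v u+v≈0 =
    antisym (≤-resp-≈ (+-identityˡ u) (trans (+-comm v u) u+v≈0) (+-mono-≤ u 0≤v)) 0≤u

module Determinants {c ℓ} (F : OrderedField c ℓ) where

  open import Data.Nat as ℕ using (ℕ; zero; suc)
  import Data.Nat.Properties as ℕ
  open import Data.Fin using (Fin; zero; suc; toℕ; punchIn; punchOut; inject₁)
  open import Data.Fin.Properties
    using (_≟_; punchInᵢ≢i; punchOut-punchIn; punchOut-cong; toℕ-inject₁; toℕ-injective; suc-injective)
  open import Data.Product using (∃; _,_; proj₁; proj₂)
  open import Data.Empty using (⊥-elim)
  open import Relation.Nullary using (yes; no)
  open import Relation.Binary.Definitions using (tri<; tri≈; tri>)
  import Relation.Binary.PropositionalEquality as ≡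
  open ≡ using (_≡_; _≢_)
  open import Function using (_∘_)
  open StrictlyIncreasingMaps
  open AdjacentTranspositions
  open OrderedFieldProperties F
  open import Algebra.Solver.CommutativeMonoid *-commutativeMonoid as *-Solver using (_⊕_; _⊜_)

  Matrix : ℕ → Set c
  Matrix m = Fin m → Fin m → Carrier

  Δ : ∀ {m} → Matrix m → Carrier
  Δ = det F

  det-cong : ∀ {m} {A B : Matrix m} → (∀ i k → A i k ≈ B i k) → Δ A ≈ Δ B
  det-cong {zero} A≈B = refl
  det-cong {suc m} A≈B =
    ∑-cong (λ j → signed-cong j (*-cong (A≈B zero j) (det-cong (λ i k → A≈B (suc i) (punchIn j k)))))

  det-cong-≡ : ∀ {m} {A B : Matrix m} → (∀ i k → A i k ≡ B i k) → Δ A ≈ Δ B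
  det-cong-≡ A≡B = det-cong (λ i k → reflexive (A≡B i k))

  prependColumn : ∀ {r k} → (Fin r → Carrier) → (Fin r → Fin k → Carrier) → Fin r → Fin (suc k) → Carrier
  prependColumn v N i zero = v i
  prependColumn v N i (suc c) = N i c

  -- κ is the vector of cofactors of the first column.
  det-linear-in-column₀ : ∀ {k} (N : Fin (suc k) → Fin k → Carrier) →
    ∃ λ (κ : Fin (suc k) → Carrier) → ∀ v → Δ (prependColumn v N) ≈ ∑ (λ i → v i * κ i)
  det-linear-in-column₀ {zero} N = (λ _ → 1#) , λ v → refl
  det-linear-in-column₀ {suc k} N = κ , linear
    where
    submatrix : Fin (suc k) → Fin (suc k) → Fin k → Carrier
    submatrix j i l = N (suc i) (punchIn j l)
    κ′ : Fin (suc k) → Fin (suc k) → Carrier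
    κ′ j = proj₁ (det-linear-in-column₀ (submatrix j))
    κ : Fin (suc (suc k)) → Carrier
    κ zero = Δ (λ i l → N (suc i) l)
    κ (suc i) = ∑ (λ j → signed F (suc j) (N zero j * κ′ j i))
    linear : ∀ v → Δ (prependColumn v N) ≈ ∑ (λ i → v i * κ i)
    linear v = +-congˡ (begin
      ∑ (λ j → signed F (suc j) (N zero j * Δ (λ i l → prependColumn v N (suc i) (punchIn (suc j) l))))
        ≈⟨ ∑-cong (λ j → signed-cong (suc j) (*-congˡ {N zero j} (trans
             (det-cong {A = λ i l → prependColumn v N (suc i) (punchIn (suc j) l)} {B = prependColumn (v ∘ suc) (submatrix j)}
                       (λ { i zero → refl ; i (suc l) → refl }))
             (proj₂ (det-linear-in-column₀ (submatrix j)) (v ∘ suc))))) ⟩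
      ∑ (λ j → signed F (suc j) (N zero j * ∑ (λ i → v (suc i) * κ′ j i)))
        ≈⟨ ∑-cong (λ j → trans (signed-cong (suc j) (*-distribˡ-∑ (N zero j) (λ i → v (suc i) * κ′ j i)))
                                (signed-∑ (suc j) (λ i → N zero j * (v (suc i) * κ′ j i)))) ⟩
      ∑ (λ j → ∑ (λ i → signed F (suc j) (N zero j * (v (suc i) * κ′ j i))))
        ≈⟨ ∑-cong (λ j → ∑-cong (λ i → trans (signed-cong (suc j) (*-CS.x∙yz≈y∙xz (N zero j) (v (suc i)) (κ′ j i)))
                                            (signed-*ˡ (suc j) (v (suc i)) (N zero j * κ′ j i)))) ⟩
      ∑ (λ j → ∑ (λ i → v (suc i) * signed F (suc j) (N zero j * κ′ j i)))
        ≈⟨ ∑-comm (λ j i → v (suc i) * signed F (suc j) (N zero j * κ′ j i)) ⟩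
      ∑ (λ i → ∑ (λ j → v (suc i) * signed F (suc j) (N zero j * κ′ j i)))
        ≈⟨ ∑-cong (λ i → sym (*-distribˡ-∑ (v (suc i)) (λ j → signed F (suc j) (N zero j * κ′ j i)))) ⟩
      ∑ (λ i → v (suc i) * κ (suc i)) ∎)

  ∑-antisym-pair : ∀ {m} (k : Fin (suc m)) (f g : Fin (suc (suc m)) → Carrier) →
                   (∀ j → j ≢ inject₁ k → j ≢ suc k → f j ≈ - g j) →
                   f (inject₁ k) ≈ - g (suc k) → f (suc k) ≈ - g (inject₁ k) → ∑ f ≈ - ∑ g
  ∑-antisym-pair zero f g f≈-g f₀≈-g₁ f₁≈-g₀ = begin
    f zero + (f (suc zero) + ∑ (λ j → f (suc (suc j))))
      ≈⟨ +-cong f₀≈-g₁ (+-cong f₁≈-g₀ (∑-cong (λ j → f≈-g (suc (suc j)) (λ ()) (λ ())))) ⟩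
    - g (suc zero) + (- g zero + ∑ (λ j → - g (suc (suc j))))
      ≈⟨ +-CS.x∙yz≈y∙xz _ _ _ ⟩
    - g zero + (- g (suc zero) + ∑ (λ j → - g (suc (suc j))))
      ≈⟨ sym (-‿distrib-∑ g) ⟩
    - ∑ g ∎
  ∑-antisym-pair {suc m} (suc k) f g f≈-g f₀≈-g₁ f₁≈-g₀ =
    trans (+-cong (f≈-g zero (λ ()) (λ ()))
                  (∑-antisym-pair k (f ∘ suc) (g ∘ suc)
                     (λ j j≢k j≢k+1 → f≈-g (suc j) (j≢k ∘ suc-injective) (j≢k+1 ∘ suc-injective)) f₀≈-g₁ f₁≈-g₀))
          (sym (-‿distrib-+ _ _))

  det-swapAdjacentColumns : ∀ {m} (k : Fin m) (M : Matrix (suc m)) → Δ (λ i c → M i (swapAdjacent k c)) ≈ - Δ M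
  det-swapAdjacentColumns {suc m} k M = ∑-antisym-pair k f g off-pair at-inject₁ at-suc
    where
    submatrix : Fin (suc (suc m)) → Matrix (suc m)
    submatrix j i l = M (suc i) (punchIn j l)
    f g : Fin (suc (suc m)) → Carrier
    f j = signed F j (M zero (swapAdjacent k j) * Δ (λ i l → M (suc i) (swapAdjacent k (punchIn j l))))
    g j = signed F j (M zero j * Δ (submatrix j))
    off-pair : ∀ j → j ≢ inject₁ k → j ≢ suc k → f j ≈ - g j
    off-pair j j≢k j≢k+1 with swapAdjacent-punchIn k j j≢k j≢k+1
    ... | k′ , commute = begin
      f j ≈⟨ signed-cong j (*-cong (reflexive (≡.cong (M zero) (swapAdjacent-fix k j j≢k j≢k+1)))
               (trans (det-cong-≡ (λ i l → ≡.cong (M (suc i)) (commute l))) (det-swapAdjacentColumns k′ (submatrix j)))) ⟩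
      signed F j (M zero j * - Δ (submatrix j))   ≈⟨ signed-cong j (sym (-‿distribʳ-* _ _)) ⟩
      signed F j (- (M zero j * Δ (submatrix j))) ≈⟨ signed-‿ j _ ⟩
      - g j ∎
    at-inject₁ : f (inject₁ k) ≈ - g (suc k)
    at-inject₁ = begin
      f (inject₁ k) ≡⟨ signed-inject₁ k _ ⟩
      signed F k (M zero (swapAdjacent k (inject₁ k)) * Δ (λ i l → M (suc i) (swapAdjacent k (punchIn (inject₁ k) l))))
        ≈⟨ signed-cong k (*-cong (reflexive (≡.cong (M zero) (swapAdjacent-inject₁ k)))
              (det-cong-≡ (λ i l → ≡.cong (M (suc i)) (swapAdjacent-punchIn-inject₁ k l)))) ⟩
      signed F k (M zero (suc k) * Δ (submatrix (suc k))) ≈⟨ sym (-‿involutive _) ⟩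
      - g (suc k) ∎
    at-suc : f (suc k) ≈ - g (inject₁ k)
    at-suc = -‿cong (begin
      signed F k (M zero (swapAdjacent k (suc k)) * Δ (λ i l → M (suc i) (swapAdjacent k (punchIn (suc k) l))))
        ≈⟨ signed-cong k (*-cong (reflexive (≡.cong (M zero) (swapAdjacent-suc k)))
              (det-cong-≡ (λ i l → ≡.cong (M (suc i)) (swapAdjacent-punchIn-suc k l)))) ⟩
      signed F k (M zero (inject₁ k) * Δ (submatrix (inject₁ k))) ≡⟨ ≡.sym (signed-inject₁ k _) ⟩
      g (inject₁ k) ∎)

  moveColumnToFront : ∀ {m} → Fin (suc m) → Matrix (suc m) → Matrix (suc m)
  moveColumnToFront z M i zero = M i z
  moveColumnToFront z M i (suc c) = M i (punchIn z c)

  -- The column is bubbled to the front by adjacent swaps; t = toℕ z is the induction variable.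
  det-moveColumnToFront : ∀ t {m} (z : Fin (suc m)) → toℕ z ≡ t → (M : Matrix (suc m)) →
                          Δ M ≈ sign t * Δ (moveColumnToFront z M)
  det-moveColumnToFront zero zero ≡.refl M =
    sym (trans (*-identityˡ _) (det-cong-≡ {A = moveColumnToFront zero M} {B = M} (λ { i zero → ≡.refl ; i (suc c) → ≡.refl })))
  det-moveColumnToFront (suc t) {suc m} (suc k) k+1≡t+1 M = begin
    Δ M ≈⟨ x≈-y⇒y≈-x (det-swapAdjacentColumns k M) ⟩
    - Δ M′ ≈⟨ -‿cong (det-moveColumnToFront t (inject₁ k) (≡.trans (toℕ-inject₁ k) (ℕ.suc-injective k+1≡t+1)) M′) ⟩
    - (sign t * Δ (moveColumnToFront (inject₁ k) M′))
      ≈⟨ -‿cong (*-congˡ (det-cong-≡ {A = moveColumnToFront (inject₁ k) M′} {B = moveColumnToFront (suc k) M}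
           (λ { i zero → ≡.cong (M i) (swapAdjacent-inject₁ k)
              ; i (suc c) → ≡.cong (M i) (swapAdjacent-punchIn-inject₁ k c) }))) ⟩
    - (sign t * Δ (moveColumnToFront (suc k) M)) ≈⟨ -‿distribˡ-* _ _ ⟩
    sign (suc t) * Δ (moveColumnToFront (suc k) M) ∎
    where
    M′ : Matrix (suc (suc m))
    M′ i c = M i (swapAdjacent k c)

  det-equal-columns : ∀ t {m} (a : Fin m) → toℕ a ≡ t → (M : Matrix (suc m)) →
                      (∀ i → M i zero ≈ M i (suc a)) → Δ M ≈ 0#
  det-equal-columns zero {suc m} zero ≡.refl M col₀≈col₁ =
    x≈-x⇒x≈0 (trans (sym (det-cong swapped≈M)) (det-swapAdjacentColumns zero M))
    where
    swapped≈M : ∀ i c → M i (swapAdjacent zero c) ≈ M i c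
    swapped≈M i zero = sym (col₀≈col₁ i)
    swapped≈M i (suc zero) = col₀≈col₁ i
    swapped≈M i (suc (suc c)) = refl
  det-equal-columns (suc t) {suc m} (suc a) a+1≡t+1 M col₀≈col = begin
    Δ M ≈⟨ x≈-y⇒y≈-x (det-swapAdjacentColumns (suc a) M) ⟩
    - Δ (λ i c → M i (swapAdjacent (suc a) c))
      ≈⟨ -‿cong (det-equal-columns t (inject₁ a) (≡.trans (toℕ-inject₁ a) (ℕ.suc-injective a+1≡t+1))
                   (λ i c → M i (swapAdjacent (suc a) c))
           (λ i → trans (col₀≈col i) (reflexive (≡.cong (λ z → M i (suc z)) (≡.sym (swapAdjacent-inject₁ a)))))) ⟩
    - 0# ≈⟨ -0#≈0# ⟩
    0# ∎

  skip₂-comm : ∀ {m} (j l : Fin (suc (suc m))) (j≢l : j ≢ l) (l≢j : l ≢ j) → ∀ b → skip₂ j l j≢l b ≡ skip₂ l j l≢j b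
  skip₂-comm j l j≢l l≢j = sameImage⇒≗ (skip₂-strictlyIncreasing j l j≢l) (skip₂-strictlyIncreasing l j l≢j)
    (λ x∈ → let _ , x≢l , x≢j = ∈Im-skip₂⁻ id-strictlyIncreasing j l j≢l x∈
            in ∈Im-skip₂⁺ id-strictlyIncreasing l j l≢j (_ , ≡.refl) x≢j x≢l)
    (λ x∈ → let _ , x≢j , x≢l = ∈Im-skip₂⁻ id-strictlyIncreasing l j l≢j x∈
            in ∈Im-skip₂⁺ id-strictlyIncreasing j l j≢l (_ , ≡.refl) x≢l x≢j)

  -- Laplace expansion of Δ W along its first two rows, with rows r₀ and r₁ put in their place.
  module TwoRowExpansion {m} (W : Matrix (suc (suc m))) where

    complement : Fin (suc (suc m)) → Fin (suc m) → Carrier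
    complement j k = Δ (λ i b → W (suc (suc i)) (punchIn j (punchIn k b)))

    term : (r₀ r₁ : Fin (suc (suc m)) → Carrier) → Fin (suc (suc m)) → Fin (suc (suc m)) → Carrier
    term r₀ r₁ j l with j ≟ l
    ... | yes _ = 0#
    ... | no j≢l = (sign (toℕ j) * sign (toℕ (punchOut j≢l))) * ((r₀ j * r₁ l) * complement j (punchOut j≢l))

    term-punchIn : ∀ r₀ r₁ j k → term r₀ r₁ j (punchIn j k) ≈
                   (sign (toℕ j) * sign (toℕ k)) * ((r₀ j * r₁ (punchIn j k)) * complement j k)
    term-punchIn r₀ r₁ j k with j ≟ punchIn j k
    ... | yes j≡ = ⊥-elim (punchInᵢ≢i j k (≡.sym j≡))
    ... | no j≢ = reflexive (≡.cong (λ z → (sign (toℕ j) * sign (toℕ z)) * ((r₀ j * r₁ (punchIn j k)) * complement j z))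
                                    (≡.trans (punchOut-cong j ≡.refl) (punchOut-punchIn j)))

    term-diagonal : ∀ r₀ r₁ j → term r₀ r₁ j j ≈ 0#
    term-diagonal r₀ r₁ j with j ≟ j
    ... | yes _ = refl
    ... | no j≢j = ⊥-elim (j≢j ≡.refl)

    expand : ∀ (r₀ r₁ : Fin (suc (suc m)) → Carrier) →
      ∑ (λ j → signed F j (r₀ j * ∑ (λ k → signed F k (r₁ (punchIn j k) * complement j k))))
        ≈ ∑ (λ j → ∑ (λ l → term r₀ r₁ j l))
    expand r₀ r₁ = ∑-cong row₀
      where
      reorder : ∀ x y a b c → x * (a * (y * (b * c))) ≈ (x * y) * ((a * b) * c)
      reorder = *-Solver.solve 5 (λ x y a b c → x ⊕ (a ⊕ (y ⊕ (b ⊕ c))) ⊜ (x ⊕ y) ⊕ ((a ⊕ b) ⊕ c)) refl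
      row₀ : ∀ j → signed F j (r₀ j * ∑ (λ k → signed F k (r₁ (punchIn j k) * complement j k))) ≈ ∑ (term r₀ r₁ j)
      row₀ j = begin
        signed F j (r₀ j * ∑ (λ k → signed F k (r₁ (punchIn j k) * complement j k)))
          ≈⟨ signed≈sign* j _ ⟩
        sign (toℕ j) * (r₀ j * ∑ (λ k → signed F k (r₁ (punchIn j k) * complement j k)))
          ≈⟨ *-congˡ (*-congˡ (∑-cong (λ k → signed≈sign* k (r₁ (punchIn j k) * complement j k)))) ⟩
        sign (toℕ j) * (r₀ j * ∑ (λ k → sign (toℕ k) * (r₁ (punchIn j k) * complement j k)))
          ≈⟨ trans (*-congˡ (*-distribˡ-∑ (r₀ j) summand)) (*-distribˡ-∑ (sign (toℕ j)) (λ k → r₀ j * summand k)) ⟩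
        ∑ (λ k → sign (toℕ j) * (r₀ j * (sign (toℕ k) * (r₁ (punchIn j k) * complement j k))))
          ≈⟨ ∑-cong (λ k → trans (reorder _ _ _ _ _) (sym (term-punchIn r₀ r₁ j k))) ⟩
        ∑ (λ k → term r₀ r₁ j (punchIn j k))
          ≈⟨ sym (trans (∑-remove j (term r₀ r₁ j)) (trans (+-congʳ (term-diagonal r₀ r₁ j)) (+-identityˡ _))) ⟩
        ∑ (term r₀ r₁ j) ∎
        where
        summand : Fin (suc m) → Carrier
        summand k = sign (toℕ k) * (r₁ (punchIn j k) * complement j k)

    sign-antisym : ∀ (j l : Fin (suc (suc m))) (j≢l : j ≢ l) (l≢j : l ≢ j) →
      sign (toℕ j) * sign (toℕ (punchOut j≢l)) ≈ - (sign (toℕ l) * sign (toℕ (punchOut l≢j)))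
    sign-antisym j l j≢l l≢j with ℕ.<-cmp (toℕ j) (toℕ l)
    ... | tri≈ _ j≡l _ = ⊥-elim (j≢l (toℕ-injective j≡l))
    ... | tri< j<l _ _ = begin
      sign (toℕ j) * sign (toℕ (punchOut j≢l))       ≈⟨ *-comm _ _ ⟩
      sign (toℕ (punchOut j≢l)) * sign (toℕ j)       ≈⟨ sym (-‿involutive _) ⟩
      - - (sign (toℕ (punchOut j≢l)) * sign (toℕ j)) ≈⟨ -‿cong (-‿distribˡ-* _ _) ⟩
      - (sign (suc (toℕ (punchOut j≢l))) * sign (toℕ j))
        ≡⟨ ≡.cong₂ (λ u v → - (sign u * sign v)) (toℕ-punchOut-> j≢l j<l) (≡.sym (toℕ-punchOut-< l≢j j<l)) ⟩
      - (sign (toℕ l) * sign (toℕ (punchOut l≢j))) ∎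
    ... | tri> _ _ l<j = begin
      sign (toℕ j) * sign (toℕ (punchOut j≢l))
        ≡⟨ ≡.cong₂ (λ u v → sign u * sign v) (≡.sym (toℕ-punchOut-> l≢j l<j)) (toℕ-punchOut-< j≢l l<j) ⟩
      (- sign (toℕ (punchOut l≢j))) * sign (toℕ l)   ≈⟨ sym (-‿distribˡ-* _ _) ⟩
      - (sign (toℕ (punchOut l≢j)) * sign (toℕ l))   ≈⟨ -‿cong (*-comm _ _) ⟩
      - (sign (toℕ l) * sign (toℕ (punchOut l≢j))) ∎

    term-swap : ∀ r₀ r₁ j l → term r₁ r₀ j l ≈ - term r₀ r₁ l j
    term-swap r₀ r₁ j l with j ≟ l | l ≟ j
    ... | yes _ | yes _ = sym -0#≈0#
    ... | yes j≡l | no l≢j = ⊥-elim (l≢j (≡.sym j≡l))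
    ... | no j≢l | yes l≡j = ⊥-elim (j≢l (≡.sym l≡j))
    ... | no j≢l | no l≢j = begin
      (sign (toℕ j) * sign (toℕ (punchOut j≢l))) * ((r₁ j * r₀ l) * complement j (punchOut j≢l))
        ≈⟨ *-cong (sign-antisym j l j≢l l≢j)
                  (*-cong (*-comm _ _) (det-cong-≡ (λ i b → ≡.cong (W (suc (suc i))) (skip₂-comm j l j≢l l≢j b)))) ⟩
      (- (sign (toℕ l) * sign (toℕ (punchOut l≢j)))) * ((r₀ l * r₁ j) * complement l (punchOut l≢j))
        ≈⟨ sym (-‿distribˡ-* _ _) ⟩
      - ((sign (toℕ l) * sign (toℕ (punchOut l≢j))) * ((r₀ l * r₁ j) * complement l (punchOut l≢j))) ∎

    det-swapRows₀₁ : Δ (λ i c → W (swapAdjacent zero i) c) ≈ - Δ W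
    det-swapRows₀₁ = begin
      Δ (λ i c → W (swapAdjacent zero i) c)              ≈⟨ expand r₁ r₀ ⟩
      ∑ (λ j → ∑ (λ l → term r₁ r₀ j l))                ≈⟨ ∑-cong (λ j → ∑-cong (λ l → term-swap r₀ r₁ j l)) ⟩
      ∑ (λ j → ∑ (λ l → - term r₀ r₁ l j))
        ≈⟨ sym (trans (-‿distrib-∑ (λ j → ∑ (λ l → term r₀ r₁ l j))) (∑-cong (λ j → -‿distrib-∑ (λ l → term r₀ r₁ l j)))) ⟩
      - ∑ (λ j → ∑ (λ l → term r₀ r₁ l j))              ≈⟨ -‿cong (sym (∑-comm (term r₀ r₁))) ⟩
      - ∑ (λ l → ∑ (λ j → term r₀ r₁ l j))              ≈⟨ -‿cong (sym (expand r₀ r₁)) ⟩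
      - Δ W ∎
      where
      r₀ r₁ : Fin (suc (suc m)) → Carrier
      r₀ = W zero
      r₁ = W (suc zero)

  det-swapAdjacentRows : ∀ {m} (k : Fin m) (W : Matrix (suc m)) → Δ (λ i c → W (swapAdjacent k i) c) ≈ - Δ W
  det-swapAdjacentRows {suc m} zero W = TwoRowExpansion.det-swapRows₀₁ W
  det-swapAdjacentRows {suc m} (suc k) W =
    trans (∑-cong (λ j → trans (signed-cong j (swap-minor j)) (signed-‿ j _)))
          (sym (-‿distrib-∑ (λ j → signed F j (W zero j * Δ (λ i l → W (suc i) (punchIn j l))))))
    where
    swap-minor : ∀ j → W zero j * Δ (λ i l → W (swapAdjacent (suc k) (suc i)) (punchIn j l))
                       ≈ - (W zero j * Δ (λ i l → W (suc i) (punchIn j l)))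
    swap-minor j = trans (*-congˡ (det-swapAdjacentRows k (λ i l → W (suc i) (punchIn j l)))) (sym (-‿distribʳ-* _ _))

  det-equal-rows : ∀ t {m} (r : Fin m) → toℕ r ≡ t → (W : Matrix (suc m)) →
                   (∀ c → W zero c ≈ W (suc r) c) → Δ W ≈ 0#
  det-equal-rows zero {suc m} zero ≡.refl W row₀≈row₁ =
    x≈-x⇒x≈0 (trans (sym (det-cong swapped≈W)) (det-swapAdjacentRows zero W))
    where
    swapped≈W : ∀ i c → W (swapAdjacent zero i) c ≈ W i c
    swapped≈W zero c = sym (row₀≈row₁ c)
    swapped≈W (suc zero) c = row₀≈row₁ c
    swapped≈W (suc (suc i)) c = refl
  det-equal-rows (suc t) {suc m} (suc a) a+1≡t+1 W row₀≈row = begin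
    Δ W ≈⟨ x≈-y⇒y≈-x (det-swapAdjacentRows (suc a) W) ⟩
    - Δ (λ i c → W (swapAdjacent (suc a) i) c)
      ≈⟨ -‿cong (det-equal-rows t (inject₁ a) (≡.trans (toℕ-inject₁ a) (ℕ.suc-injective a+1≡t+1))
                   (λ i c → W (swapAdjacent (suc a) i) c)
                   (λ c → trans (row₀≈row c) (reflexive (≡.cong (λ z → W (suc z) c) (≡.sym (swapAdjacent-inject₁ a)))))) ⟩
    - 0# ≈⟨ -0#≈0# ⟩
    0# ∎

module PlückerRelation {c ℓ} (F : OrderedField c ℓ) where

  open import Data.Nat as ℕ using (ℕ; zero; suc)
  import Data.Nat.Properties as ℕ
  open import Data.Fin using (Fin; zero; suc; toℕ; punchIn; punchOut) renaming (_<_ to _<ᶠ_)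
  open import Data.Fin.Properties using (punchIn-injective; punchIn-punchOut; punchOut-injective; <⇒≢; <-trans)
  open import Data.Product using (_×_; _,_; proj₁; proj₂)
  import Relation.Binary.PropositionalEquality as ≡
  open ≡ using (_≡_; _≢_; ≢-sym)
  open import Function using (_∘_)
  open StrictlyIncreasingMaps
  open AdjacentTranspositions
  open OrderedFieldProperties F
  open Determinants F

  skip₂-index : ∀ {k} {Y X W : Fin (suc (suc (suc k)))} (Y≢X : Y ≢ X) (Y≢W : Y ≢ W) → X ≢ W → Fin (suc k)
  skip₂-index Y≢X Y≢W X≢W = punchOut (X≢W ∘ punchOut-injective Y≢X Y≢W)

  skip₂-skip₂-index : ∀ {k} {Y X W : Fin (suc (suc (suc k)))} (Y≢X : Y ≢ X) (Y≢W : Y ≢ W) (X≢W : X ≢ W) →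
                      skip₂ Y X Y≢X (skip₂-index Y≢X Y≢W X≢W) ≡ W
  skip₂-skip₂-index {Y = Y} Y≢X Y≢W X≢W = ≡.trans (≡.cong (punchIn Y) (punchIn-punchOut _)) (punchIn-punchOut Y≢W)

  module _ {k} {Y X W : Fin (suc (suc (suc k)))} (Y≢X : Y ≢ X) (Y≢W : Y ≢ W) (X≢W : X ≢ W) where

    private
      g : Fin (suc k) → Fin (suc (suc (suc k)))
      g = skip₂ Y X Y≢X
      i : Fin (suc k)
      i = skip₂-index Y≢X Y≢W X≢W

    ∈Im-skip₃⁻ : ∀ {x} → x ∈Im (g ∘ punchIn i) → x ≢ W × x ≢ X × x ≢ Y
    ∈Im-skip₃⁻ x∈ with ∈Im-∘punchIn⁻ (skip₂-strictlyIncreasing Y X Y≢X) i x∈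
    ... | x∈g , x≢gi with ∈Im-skip₂⁻ id-strictlyIncreasing Y X Y≢X x∈g
    ... | _ , x≢X , x≢Y = (λ x≡W → x≢gi (≡.trans x≡W (≡.sym (skip₂-skip₂-index Y≢X Y≢W X≢W)))) , x≢X , x≢Y

    ∈Im-skip₃⁺ : ∀ {x} → x ≢ W → x ≢ X → x ≢ Y → x ∈Im (g ∘ punchIn i)
    ∈Im-skip₃⁺ {x} x≢W x≢X x≢Y =
      ∈Im-∘punchIn⁺ i (∈Im-skip₂⁺ id-strictlyIncreasing Y X Y≢X (x , ≡.refl) x≢X x≢Y)
                      (λ x≡gi → x≢W (≡.trans x≡gi (skip₂-skip₂-index Y≢X Y≢W X≢W)))

    skip₃-strictlyIncreasing : StrictlyIncreasing (g ∘ punchIn i)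
    skip₃-strictlyIncreasing = strictlyIncreasing-∘ (skip₂-strictlyIncreasing Y X Y≢X) (punchIn-strictlyIncreasing i)

  module FourPositions {m} {P Q R Z : Fin m} (P<Q : P <ᶠ Q) (Q<R : Q <ᶠ R) (R<Z : R <ᶠ Z) where

    P<R : P <ᶠ R
    P<R = <-trans P<Q Q<R
    Q<Z : Q <ᶠ Z
    Q<Z = <-trans Q<R R<Z
    P<Z : P <ᶠ Z
    P<Z = <-trans P<R R<Z

    P≢Q : P ≢ Q
    P≢Q = <⇒≢ P<Q
    P≢R : P ≢ R
    P≢R = <⇒≢ P<R
    Q≢R : Q ≢ R
    Q≢R = <⇒≢ Q<R
    Q≢P : Q ≢ P
    Q≢P = ≢-sym P≢Q
    R≢P : R ≢ P
    R≢P = ≢-sym P≢R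
    R≢Q : R ≢ Q
    R≢Q = ≢-sym Q≢R
    Z≢P : Z ≢ P
    Z≢P = ≢-sym (<⇒≢ P<Z)
    Z≢Q : Z ≢ Q
    Z≢Q = ≢-sym (<⇒≢ Q<Z)
    Z≢R : Z ≢ R
    Z≢R = ≢-sym (<⇒≢ R<Z)

  module _ {e} (X : Fin (suc (suc e)) → Fin (suc (suc (suc (suc e)))) → Carrier) where

    minorOn : (Fin (suc (suc e)) → Fin (suc (suc (suc (suc e))))) → Carrier
    minorOn g = Δ (λ i k → X i (g k))

    module ThreeTermPlücker (P Q R Z : Fin (suc (suc (suc (suc e))))) (P<Q : P <ᶠ Q) (Q<R : Q <ᶠ R) (R<Z : R <ᶠ Z) where

      open FourPositions P<Q Q<R R<Z public

      τ : Fin (suc (suc (suc e))) → Fin (suc (suc (suc (suc e))))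
      τ = punchIn Z

      cofactor : Fin (suc (suc (suc e))) → Carrier
      cofactor t = minorOn (τ ∘ punchIn t)

      -- Laplace expansion of the determinant with row i repeated on top.
      cofactor-expansion-vanishes : ∀ i → ∑ (λ t → signed F t (X i (τ t) * cofactor t)) ≈ 0#
      cofactor-expansion-vanishes i = det-equal-rows (toℕ i) i ≡.refl W (λ _ → refl)
        where
        W : Matrix (suc (suc (suc e)))
        W zero c = X i (τ c)
        W (suc a) c = X a (τ c)

      -- ν lists the positions other than P, Q and R; the same list arises from skip₂ R Q, skip₂ R P and skip₂ Q P.
      ν : Fin (suc e) → Fin (suc (suc (suc (suc e))))
      ν = skip₂ R Q R≢Q ∘ punchIn (skip₂-index R≢Q R≢P Q≢P)

      ν-unique : ∀ {Y X W} (Y≢X : Y ≢ X) (Y≢W : Y ≢ W) (X≢W : X ≢ W) →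
                 (∀ {x} → x ≢ W → x ≢ X → x ≢ Y → x ≢ P × x ≢ Q × x ≢ R) →
                 (∀ {x} → x ≢ P → x ≢ Q → x ≢ R → x ≢ W × x ≢ X × x ≢ Y) →
                 ∀ b → skip₂ Y X Y≢X (punchIn (skip₂-index Y≢X Y≢W X≢W) b) ≡ ν b
      ν-unique Y≢X Y≢W X≢W to from = sameImage⇒≗
        (skip₃-strictlyIncreasing Y≢X Y≢W X≢W) (skip₃-strictlyIncreasing R≢Q R≢P Q≢P)
        (λ x∈ → let a , b , c = ∈Im-skip₃⁻ Y≢X Y≢W X≢W x∈ ; p , q , r = to a b c in ∈Im-skip₃⁺ R≢Q R≢P Q≢P p q r)
        (λ x∈ → let p , q , r = ∈Im-skip₃⁻ R≢Q R≢P Q≢P x∈ ; a , b , c = from p q r in ∈Im-skip₃⁺ Y≢X Y≢W X≢W a b c)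

      N : Fin (suc (suc e)) → Fin (suc e) → Carrier
      N i b = X i (ν b)

      ψ : (Fin (suc (suc e)) → Carrier) → Carrier
      ψ v = Δ (prependColumn v N)

      ψ-at-column : ∀ (g : Fin (suc (suc e)) → Fin (suc (suc (suc (suc e))))) k → (∀ b → g (punchIn k b) ≡ ν b) →
                    ψ (λ i → X i (g k)) ≈ sign (toℕ k) * minorOn g
      ψ-at-column g k g∘punchIn≗ν = begin
        ψ (λ i → X i (g k))                                  ≈⟨ sym (*-identityˡ _) ⟩
        1# * ψ (λ i → X i (g k))                             ≈⟨ *-congʳ (sym (sign*sign (toℕ k))) ⟩
        (sign (toℕ k) * sign (toℕ k)) * ψ (λ i → X i (g k))  ≈⟨ *-assoc _ _ _ ⟩
        sign (toℕ k) * (sign (toℕ k) * ψ (λ i → X i (g k)))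
          ≈⟨ *-congˡ (sym (trans (det-moveColumnToFront (toℕ k) k ≡.refl (λ i l → X i (g l)))
                                 (*-congˡ (det-cong-≡ {A = moveColumnToFront k (λ i l → X i (g l))}
                                                      {B = prependColumn (λ i → X i (g k)) N}
                                   (λ { i zero → ≡.refl ; i (suc b) → ≡.cong (X i) (g∘punchIn≗ν b) }))))) ⟩
        sign (toℕ k) * minorOn g                             ∎

      term : Fin (suc (suc (suc e))) → Carrier
      term t = signed F t (cofactor t * ψ (λ i → X i (τ t)))

      ∑-term≈0 : ∑ term ≈ 0#
      ∑-term≈0 = begin
        ∑ term                                                              ≈⟨ ∑-cong expand ⟩
        ∑ (λ t → ∑ (λ i → signed F t (X i (τ t) * cofactor t) * κ i))      ≈⟨ ∑-comm (λ t i → expansion i t * κ i) ⟩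
        ∑ (λ i → ∑ (λ t → signed F t (X i (τ t) * cofactor t) * κ i))
          ≈⟨ ∑-zero (λ i → trans (sym (*-distribʳ-∑ (κ i) (expansion i)))
                                 (trans (*-congʳ (cofactor-expansion-vanishes i)) (zeroˡ (κ i)))) ⟩
        0#                                                                  ∎
        where
        κ : Fin (suc (suc e)) → Carrier
        κ = proj₁ (det-linear-in-column₀ N)
        expansion : Fin (suc (suc e)) → Fin (suc (suc (suc e))) → Carrier
        expansion i t = signed F t (X i (τ t) * cofactor t)
        expand : ∀ t → term t ≈ ∑ (λ i → signed F t (X i (τ t) * cofactor t) * κ i)
        expand t = begin
          signed F t (cofactor t * ψ (λ i → X i (τ t)))
            ≈⟨ signed-cong t (*-congˡ (proj₂ (det-linear-in-column₀ N) (λ i → X i (τ t)))) ⟩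
          signed F t (cofactor t * ∑ (λ i → X i (τ t) * κ i))
            ≈⟨ trans (signed-cong t (*-distribˡ-∑ (cofactor t) (λ i → X i (τ t) * κ i)))
                     (signed-∑ t (λ i → cofactor t * (X i (τ t) * κ i))) ⟩
          ∑ (λ i → signed F t (cofactor t * (X i (τ t) * κ i)))
            ≈⟨ ∑-cong (λ i → trans (signed-cong t (*-CS.x∙yz≈yx∙z (cofactor t) (X i (τ t)) (κ i))) (signed-*ʳ t _ (κ i))) ⟩
          ∑ (λ i → signed F t (X i (τ t) * cofactor t) * κ i) ∎

      term-at : ∀ t g k → g k ≡ τ t → (∀ b → g (punchIn k b) ≡ ν b) →
                term t ≈ sign (toℕ t) * (cofactor t * (sign (toℕ k) * minorOn g))
      term-at t g k gk≡τt g∘punchIn≗ν = begin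
        signed F t (cofactor t * ψ (λ i → X i (τ t)))         ≈⟨ signed≈sign* t _ ⟩
        sign (toℕ t) * (cofactor t * ψ (λ i → X i (τ t)))
          ≡⟨ ≡.cong (λ x → sign (toℕ t) * (cofactor t * ψ (λ i → X i x))) (≡.sym gk≡τt) ⟩
        sign (toℕ t) * (cofactor t * ψ (λ i → X i (g k)))     ≈⟨ *-congˡ (*-congˡ (ψ-at-column g k g∘punchIn≗ν)) ⟩
        sign (toℕ t) * (cofactor t * (sign (toℕ k) * minorOn g)) ∎

      term-vanishes : ∀ t → t ≢ punchOut Z≢P → t ≢ punchOut Z≢Q → t ≢ punchOut Z≢R → term t ≈ 0#
      term-vanishes t t≢P t≢Q t≢R with ∈Im-skip₃⁺ R≢Q R≢P Q≢P (avoid Z≢P t≢P) (avoid Z≢Q t≢Q) (avoid Z≢R t≢R)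
        where
        avoid : ∀ {Y} (Z≢Y : Z ≢ Y) → t ≢ punchOut Z≢Y → τ t ≢ Y
        avoid Z≢Y t≢Y τt≡Y = t≢Y (punchIn-injective Z t _ (≡.trans τt≡Y (≡.sym (punchIn-punchOut Z≢Y))))
      ... | j , νj≡τt = begin
        signed F t (cofactor t * ψ (λ i → X i (τ t)))
          ≈⟨ signed-cong t (*-congˡ (det-equal-columns (toℕ j) j ≡.refl (prependColumn (λ i → X i (τ t)) N)
                                       (λ i → reflexive (≡.cong (X i) (≡.sym νj≡τt))))) ⟩
        signed F t (cofactor t * 0#) ≈⟨ trans (signed-cong t (zeroʳ _)) (trans (signed≈sign* t 0#) (zeroʳ _)) ⟩
        0# ∎

      term-P : term (punchOut Z≢P) ≈ minorOn (skip₂ Z P Z≢P) * minorOn (skip₂ R Q R≢Q)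
      term-P = trans (term-at _ (skip₂ R Q R≢Q) kp (≡.trans (skip₂-skip₂-index R≢Q R≢P Q≢P) (≡.sym (punchIn-punchOut Z≢P)))
                              (λ _ → ≡.refl))
                     (sign-cancel _ _ _ _ (≡.trans (toℕ-punchOut-< Z≢P P<Z) (≡.sym toℕ-kp)))
        where
        kp : Fin (suc (suc e))
        kp = skip₂-index R≢Q R≢P Q≢P
        toℕ-kp : toℕ kp ≡ toℕ P
        toℕ-kp = ≡.trans (toℕ-punchOut-< _ (punchOut-< R≢P R≢Q P<R Q<R P<Q)) (toℕ-punchOut-< R≢P P<R)

      term-Q : term (punchOut Z≢Q) ≈ - (minorOn (skip₂ Z Q Z≢Q) * minorOn (skip₂ R P R≢P))
      term-Q = trans (term-at _ (skip₂ R P R≢P) kq (≡.trans (skip₂-skip₂-index R≢P R≢Q P≢Q) (≡.sym (punchIn-punchOut Z≢Q)))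
                              (ν-unique R≢P R≢Q P≢Q (λ x≢Q x≢P x≢R → x≢P , x≢Q , x≢R) (λ x≢P x≢Q x≢R → x≢Q , x≢P , x≢R)))
                     (sign-cancel-suc _ _ _ _ (≡.trans (toℕ-punchOut-< Z≢Q Q<Z) (≡.sym toℕ-kq)))
        where
        kq : Fin (suc (suc e))
        kq = skip₂-index R≢P R≢Q P≢Q
        toℕ-kq : suc (toℕ kq) ≡ toℕ Q
        toℕ-kq = ≡.trans (toℕ-punchOut-> _ (punchOut-< R≢P R≢Q P<R Q<R P<Q)) (toℕ-punchOut-< R≢Q Q<R)

      term-R : term (punchOut Z≢R) ≈ minorOn (skip₂ Z R Z≢R) * minorOn (skip₂ Q P Q≢P)
      term-R = trans (term-at _ (skip₂ Q P Q≢P) kr (≡.trans (skip₂-skip₂-index Q≢P Q≢R P≢R) (≡.sym (punchIn-punchOut Z≢R)))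
                              (ν-unique Q≢P Q≢R P≢R (λ x≢R x≢P x≢Q → x≢P , x≢Q , x≢R) (λ x≢P x≢Q x≢R → x≢R , x≢P , x≢Q)))
                     (sign-cancel-suc-suc _ _ _ _ (≡.trans (toℕ-punchOut-< Z≢R R<Z) (≡.sym toℕ-kr)))
        where
        kr : Fin (suc (suc e))
        kr = skip₂-index Q≢P Q≢R P≢R
        P′<R′ : punchOut Q≢P <ᶠ punchOut Q≢R
        P′<R′ = ≡.subst (ℕ._< toℕ (punchOut Q≢R)) (≡.sym (toℕ-punchOut-< Q≢P P<Q))
                  (ℕ.<-≤-trans P<Q (ℕ.≤-pred (≡.subst (suc (toℕ Q) ℕ.≤_) (≡.sym (toℕ-punchOut-> Q≢R Q<R)) Q<R)))
        toℕ-kr : suc (suc (toℕ kr)) ≡ toℕ R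
        toℕ-kr = ≡.trans (≡.cong suc (toℕ-punchOut-> _ P′<R′)) (toℕ-punchOut-> Q≢R Q<R)

      plücker : minorOn (skip₂ Z P Z≢P) * minorOn (skip₂ R Q R≢Q) + minorOn (skip₂ Z R Z≢R) * minorOn (skip₂ Q P Q≢P)
                ≈ minorOn (skip₂ Z Q Z≢Q) * minorOn (skip₂ R P R≢P)
      plücker = sym (begin
        v                  ≈⟨ sym (+-identityʳ v) ⟩
        v + 0#             ≈⟨ +-congˡ (sym alternating) ⟩
        v + (u + (- v + w)) ≈⟨ +-CS.x∙yz≈y∙xz v u _ ⟩
        u + (v + (- v + w)) ≈⟨ +-congˡ (trans (sym (+-assoc v (- v) w)) (trans (+-congʳ (-‿inverseʳ v)) (+-identityˡ w))) ⟩
        u + w              ∎)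
        where
        u v w : Carrier
        u = minorOn (skip₂ Z P Z≢P) * minorOn (skip₂ R Q R≢Q)
        v = minorOn (skip₂ Z Q Z≢Q) * minorOn (skip₂ R P R≢P)
        w = minorOn (skip₂ Z R Z≢R) * minorOn (skip₂ Q P Q≢P)
        alternating : u + (- v + w) ≈ 0#
        alternating = begin
          u + (- v + w)  ≈⟨ sym (+-cong term-P (+-cong term-Q term-R)) ⟩
          term (punchOut Z≢P) + (term (punchOut Z≢Q) + term (punchOut Z≢R))
            ≈⟨ sym (∑-triple _ _ _ (<⇒≢ (punchOut-< Z≢P Z≢Q P<Z Q<Z P<Q)) (<⇒≢ (punchOut-< Z≢P Z≢R P<Z R<Z P<R))
                                 (<⇒≢ (punchOut-< Z≢Q Z≢R Q<Z R<Z Q<R)) term term-vanishes) ⟩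
          ∑ term         ≈⟨ ∑-term≈0 ⟩
          0#             ∎

module PositroidExchange {c ℓ} (F : OrderedField c ℓ) where

  open import Data.Nat as ℕ using (ℕ; zero; suc; z≤n; s≤s)
  import Data.Nat.Properties as ℕ
  open import Data.Fin using (Fin; zero; suc; toℕ) renaming (_<_ to _<ᶠ_)
  open import Data.Fin.Subset using (Subset; _∈_; _∉_; _∪_; ⁅_⁆; ⊤)
  open import Data.Fin.Subset.Properties using (x∈p∪q⁻; x∈p∪q⁺; x∈⁅y⁆⇔x≡y; x∈⁅x⁆; ∈⊤; ∪-commutativeMonoid)
  open import Data.Product using (∃; _×_; _,_)
  open import Data.Sum using (_⊎_; inj₁; inj₂)
  open import Data.Empty using (⊥-elim)
  open import Relation.Nullary using (¬_)
  import Relation.Binary.PropositionalEquality as ≡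
  open ≡ using (_≡_; _≢_; ≢-sym)
  open import Function using (_∘_)
  open import Function.Bundles using (_⇔_; Equivalence; mk⇔)
  open Matroid using (ground; IsBasis)
  open StrictlyIncreasingMaps
  open OrderedFieldProperties F
  open Determinants F
  open PlückerRelation F
  import Algebra.Solver.CommutativeMonoid

  _∪⁅_,_⁆ : ∀ {n} → Subset n → Fin n → Fin n → Subset n
  S ∪⁅ a , b ⁆ = S ∪ (⁅ a ⁆ ∪ ⁅ b ⁆)

  module _ {n} {S : Subset n} {a b : Fin n} where

    ∈-∪⁅,⁆⁻ : ∀ {x} → x ∈ S ∪⁅ a , b ⁆ → x ∈ S ⊎ x ≡ a ⊎ x ≡ b
    ∈-∪⁅,⁆⁻ x∈ with x∈p∪q⁻ S _ x∈
    ... | inj₁ x∈S = inj₁ x∈S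
    ... | inj₂ x∈ab with x∈p∪q⁻ ⁅ a ⁆ ⁅ b ⁆ x∈ab
    ... | inj₁ x∈a = inj₂ (inj₁ (Equivalence.to x∈⁅y⁆⇔x≡y x∈a))
    ... | inj₂ x∈b = inj₂ (inj₂ (Equivalence.to x∈⁅y⁆⇔x≡y x∈b))

    ∈-∪⁅,⁆⁺ : ∀ {x} → x ∈ S ⊎ x ≡ a ⊎ x ≡ b → x ∈ S ∪⁅ a , b ⁆
    ∈-∪⁅,⁆⁺ (inj₁ x∈S) = x∈p∪q⁺ (inj₁ x∈S)
    ∈-∪⁅,⁆⁺ (inj₂ (inj₁ ≡.refl)) = x∈p∪q⁺ (inj₂ (x∈p∪q⁺ (inj₁ (x∈⁅x⁆ a))))
    ∈-∪⁅,⁆⁺ (inj₂ (inj₂ ≡.refl)) = x∈p∪q⁺ (inj₂ (x∈p∪q⁺ (inj₂ (x∈⁅x⁆ b))))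

    ∉-∪⁅,⁆ : ∀ {x} → x ∉ S → x ≢ a → x ≢ b → x ∉ S ∪⁅ a , b ⁆
    ∉-∪⁅,⁆ x∉S x≢a x≢b x∈ with ∈-∪⁅,⁆⁻ x∈
    ... | inj₁ x∈S = x∉S x∈S
    ... | inj₂ (inj₁ x≡a) = x≢a x≡a
    ... | inj₂ (inj₂ x≡b) = x≢b x≡b

  isImage-skip₂ : ∀ {k n} {ω : Fin (suc (suc k)) → Fin n} {T : Subset n} → StrictlyIncreasing ω →
                  ∀ Y X (Y≢X : Y ≢ X) → IsImage ω (T ∪⁅ ω X , ω Y ⁆) → ω X ∉ T → ω Y ∉ T →
                  IsImage (ω ∘ skip₂ Y X Y≢X) T
  isImage-skip₂ {ω = ω} ω↑ Y X Y≢X imω ωX∉T ωY∉T x = mk⇔ to from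
    where
    to : x ∈ _ → x ∈Im (ω ∘ skip₂ Y X Y≢X)
    to x∈T = ∈Im-skip₂⁺ ω↑ Y X Y≢X (Equivalence.to (imω x) (∈-∪⁅,⁆⁺ (inj₁ x∈T)))
                        (λ { ≡.refl → ωX∉T x∈T }) (λ { ≡.refl → ωY∉T x∈T })
    from : x ∈Im (ω ∘ skip₂ Y X Y≢X) → x ∈ _
    from x∈ with ∈Im-skip₂⁻ ω↑ Y X Y≢X x∈
    ... | x∈ω , x≢ωX , x≢ωY with ∈-∪⁅,⁆⁻ (Equivalence.from (imω x) x∈ω)
    ... | inj₁ x∈T = x∈T
    ... | inj₂ (inj₁ x≡ωX) = ⊥-elim (x≢ωX x≡ωX)
    ... | inj₂ (inj₂ x≡ωY) = ⊥-elim (x≢ωY x≡ωY)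

  module EnumeratedFourPoints {n e} {ω : Fin (suc (suc (suc (suc e)))) → Fin n} (ω↑ : StrictlyIncreasing ω) {S : Subset n}
    {P Q R Z} (P<Q : P <ᶠ Q) (Q<R : Q <ᶠ R) (R<Z : R <ᶠ Z) (imω : IsImage ω (S ∪⁅ ω Q , ω R ⁆ ∪⁅ ω P , ω Z ⁆))
    (P∉S : ω P ∉ S) (Q∉S : ω Q ∉ S) (R∉S : ω R ∉ S) (Z∉S : ω Z ∉ S) where

    open FourPositions P<Q Q<R R<Z public

    private
      module ∪-Solver = Algebra.Solver.CommutativeMonoid (∪-commutativeMonoid n)
      open ∪-Solver using (_⊕_; _⊜_)

      ≢ω : ∀ {X Y} → X ≢ Y → ω X ≢ ω Y
      ≢ω X≢Y ωX≡ωY = X≢Y (strictlyIncreasing⇒injective ω↑ _ _ ωX≡ωY)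

    ω∘skip₂↑ : ∀ Y X (Y≢X : Y ≢ X) → StrictlyIncreasing (ω ∘ skip₂ Y X Y≢X)
    ω∘skip₂↑ Y X Y≢X = strictlyIncreasing-∘ ω↑ (skip₂-strictlyIncreasing Y X Y≢X)

    image-without-PZ : IsImage (ω ∘ skip₂ Z P Z≢P) (S ∪⁅ ω Q , ω R ⁆)
    image-without-PZ = isImage-skip₂ ω↑ Z P Z≢P imω
      (∉-∪⁅,⁆ P∉S (≢ω P≢Q) (≢ω P≢R)) (∉-∪⁅,⁆ Z∉S (≢ω Z≢Q) (≢ω Z≢R))

    image-without-QR : IsImage (ω ∘ skip₂ R Q R≢Q) (S ∪⁅ ω P , ω Z ⁆)
    image-without-QR = isImage-skip₂ ω↑ R Q R≢Q (≡.subst (IsImage ω) rearrange imω)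
      (∉-∪⁅,⁆ Q∉S (≢ω Q≢P) (≢ω (≢-sym Z≢Q))) (∉-∪⁅,⁆ R∉S (≢ω R≢P) (≢ω (≢-sym Z≢R)))
      where
      rearrange : S ∪⁅ ω Q , ω R ⁆ ∪⁅ ω P , ω Z ⁆ ≡ S ∪⁅ ω P , ω Z ⁆ ∪⁅ ω Q , ω R ⁆
      rearrange = ∪-Solver.solve 5 (λ s p q r z → (s ⊕ (q ⊕ r)) ⊕ (p ⊕ z) ⊜ (s ⊕ (p ⊕ z)) ⊕ (q ⊕ r)) ≡.refl _ _ _ _ _

    image-without-QZ : IsImage (ω ∘ skip₂ Z Q Z≢Q) (S ∪⁅ ω P , ω R ⁆)
    image-without-QZ = isImage-skip₂ ω↑ Z Q Z≢Q (≡.subst (IsImage ω) rearrange imω)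
      (∉-∪⁅,⁆ Q∉S (≢ω Q≢P) (≢ω Q≢R)) (∉-∪⁅,⁆ Z∉S (≢ω Z≢P) (≢ω Z≢R))
      where
      rearrange : S ∪⁅ ω Q , ω R ⁆ ∪⁅ ω P , ω Z ⁆ ≡ S ∪⁅ ω P , ω R ⁆ ∪⁅ ω Q , ω Z ⁆
      rearrange = ∪-Solver.solve 5 (λ s p q r z → (s ⊕ (q ⊕ r)) ⊕ (p ⊕ z) ⊜ (s ⊕ (p ⊕ r)) ⊕ (q ⊕ z)) ≡.refl _ _ _ _ _

  -- Only the columns in the ground set are constrained, hence ground M ≡ ⊤.
  module PositroidMinors {n} (M : Matroid n) (ground≡⊤ : ground M ≡ ⊤) {d} (A : Fin d → Fin n → Carrier)
    (nonneg : ∀ col → StrictlyIncreasing col → (∀ i → col i ∈ ground M) → 0# ≤ minor F A col)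
    (basis⇔ : ∀ B → IsBasis M B ⇔
      (∃ λ col → StrictlyIncreasing col × (∀ i → col i ∈ ground M) × IsImage col B × ¬ (minor F A col ≈ 0#))) where

    in-ground : ∀ {k} (g : Fin k → Fin n) i → g i ∈ ground M
    in-ground g i = ≡.subst (g i ∈_) (≡.sym ground≡⊤) ∈⊤

    minor-nonneg : ∀ g → StrictlyIncreasing g → 0# ≤ minor F A g
    minor-nonneg g g↑ = nonneg g g↑ (in-ground g)

    basis-length : ∀ {B k} {g : Fin k → Fin n} → IsBasis M B → StrictlyIncreasing g → IsImage g B → k ≡ d
    basis-length {B} B-basis g↑ img with Equivalence.to (basis⇔ B) B-basis
    ... | γ , γ↑ , _ , imγ , _ = sameImage⇒sameLength g↑ γ↑ (isImage⇒⊆Im img imγ) (isImage⇒⊆Im imγ img)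

    basis⇔minor≉0 : ∀ B g → StrictlyIncreasing g → IsImage g B → IsBasis M B ⇔ (¬ (minor F A g ≈ 0#))
    basis⇔minor≉0 B g g↑ img = mk⇔ to (λ minor≉0 → Equivalence.from (basis⇔ B) (g , g↑ , in-ground g , img , minor≉0))
      where
      to : IsBasis M B → ¬ (minor F A g ≈ 0#)
      to B-basis with Equivalence.to (basis⇔ B) B-basis
      ... | γ , γ↑ , _ , imγ , minorγ≉0 = λ minor≈0 →
        minorγ≉0 (trans (sym (det-cong-≡ (λ i k → ≡.cong (A i) (g≗γ k)))) minor≈0)
        where
        g≗γ : ∀ k → g k ≡ γ k
        g≗γ = sameImage⇒≗ g↑ γ↑ (isImage⇒⊆Im img imγ) (isImage⇒⊆Im imγ img)

    -- Δ_{Spr} Δ_{Sqs} = Δ_{Sqr} Δ_{Sps} + Δ_{Spq} Δ_{Srs} ≥ Δ_{Sqr} Δ_{Sps} > 0.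
    exchange-on-enumeration : ∀ {e} (ω : Fin (suc (suc (suc (suc e)))) → Fin n) (ω↑ : StrictlyIncreasing ω) →
      ∀ S {P Q R Z} (P<Q : P <ᶠ Q) (Q<R : Q <ᶠ R) (R<Z : R <ᶠ Z) → IsImage ω (S ∪⁅ ω Q , ω R ⁆ ∪⁅ ω P , ω Z ⁆) →
      ω P ∉ S → ω Q ∉ S → ω R ∉ S → ω Z ∉ S →
      IsBasis M (S ∪⁅ ω Q , ω R ⁆) → IsBasis M (S ∪⁅ ω P , ω Z ⁆) → IsBasis M (S ∪⁅ ω P , ω R ⁆)
    exchange-on-enumeration {e} ω ω↑ S {P} {Q} {R} {Z} P<Q Q<R R<Z imω P∉S Q∉S R∉S Z∉S Sqr Sps
      with basis-length Sqr (ω∘skip₂↑ Z P Z≢P) image-without-PZ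
      where open EnumeratedFourPoints ω↑ P<Q Q<R R<Z imω P∉S Q∉S R∉S Z∉S
    ... | ≡.refl = Equivalence.from (basis⇔minor≉0 _ _ (ω∘skip₂↑ Z Q Z≢Q) image-without-QZ) Spr-minor≉0
      where
      open EnumeratedFourPoints ω↑ P<Q Q<R R<Z imω P∉S Q∉S R∉S Z∉S
      open ThreeTermPlücker (λ i k → A i (ω k)) P Q R Z P<Q Q<R R<Z using (plücker)
      ≥0 : ∀ Y X (Y≢X : Y ≢ X) → 0# ≤ minorOn (λ i k → A i (ω k)) (skip₂ Y X Y≢X)
      ≥0 Y X Y≢X = minor-nonneg _ (ω∘skip₂↑ Y X Y≢X)
      Spr-minor≉0 : ¬ (minorOn (λ i k → A i (ω k)) (skip₂ Z Q Z≢Q) ≈ 0#)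
      Spr-minor≉0 Spr≈0 =
        x*y≉0 (Equivalence.to (basis⇔minor≉0 _ _ (ω∘skip₂↑ Z P Z≢P) image-without-PZ) Sqr)
              (Equivalence.to (basis⇔minor≉0 _ _ (ω∘skip₂↑ R Q R≢Q) image-without-QR) Sps)
              (nonneg+nonneg≈0⇒≈0 (*-nonneg (≥0 Z P Z≢P) (≥0 R Q R≢Q)) (*-nonneg (≥0 Z R Z≢R) (≥0 Q P Q≢P))
                (trans plücker (trans (*-congʳ Spr≈0) (zeroˡ _))))

  positroid-exchange : ∀ {n} (M : Matroid n) → ground M ≡ ⊤ → IsPositroid F M →
    ∀ S {p q r s} → p <ᶠ q → q <ᶠ r → r <ᶠ s → p ∉ S → q ∉ S → r ∉ S → s ∉ S →
    IsBasis M (S ∪⁅ q , r ⁆) → IsBasis M (S ∪⁅ p , s ⁆) → IsBasis M (S ∪⁅ p , r ⁆)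
  positroid-exchange M ground≡⊤ (d , A , _ , nonneg , basis⇔) S {p} {q} {r} {s} p<q q<r r<s p∉S q∉S r∉S s∉S
    with enumerate (S ∪⁅ q , r ⁆ ∪⁅ p , s ⁆)
  ... | a , ω , ω↑ , imω
    with position p (inj₂ (inj₁ ≡.refl)) | position q (inj₁ (∈-∪⁅,⁆⁺ (inj₂ (inj₁ ≡.refl))))
       | position r (inj₁ (∈-∪⁅,⁆⁺ (inj₂ (inj₂ ≡.refl)))) | position s (inj₂ (inj₂ ≡.refl))
    where
    position : ∀ x → x ∈ S ∪⁅ q , r ⁆ ⊎ x ≡ p ⊎ x ≡ s → x ∈Im ω
    position x x∈ = Equivalence.to (imω x) (∈-∪⁅,⁆⁺ x∈)
  ... | P , ≡.refl | Q , ≡.refl | R , ≡.refl | Z , ≡.refl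
    with strictlyIncreasing-reflects-< ω↑ P Q p<q | strictlyIncreasing-reflects-< ω↑ Q R q<r
       | strictlyIncreasing-reflects-< ω↑ R Z r<s
  ... | P<Q | Q<R | R<Z with ≥3⇒4+ Z (ℕ.≤-trans (s≤s (s≤s (s≤s z≤n))) (ℕ.≤-trans (s≤s (s≤s P<Q)) (ℕ.≤-trans (s≤s Q<R) R<Z)))
    where
    ≥3⇒4+ : ∀ {k} (Z : Fin k) → 3 ℕ.≤ toℕ Z → ∃ λ e → k ≡ suc (suc (suc (suc e)))
    ≥3⇒4+ {suc (suc (suc (suc e)))} Z _ = e , ≡.refl
    ≥3⇒4+ {suc zero} zero ()
    ≥3⇒4+ {suc (suc zero)} (suc zero) (s≤s ())
    ≥3⇒4+ {suc (suc (suc zero))} (suc (suc zero)) (s≤s (s≤s ()))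
  ... | e , ≡.refl =
    PositroidMinors.exchange-on-enumeration M ground≡⊤ A nonneg basis⇔ ω ω↑ S P<Q Q<R R<Z imω p∉S q∉S r∉S s∉S

module MatroidDecomposition where

  open import Data.Nat as ℕ using (ℕ; zero; suc)
  import Data.Nat.Properties as ℕ
  open import Data.Fin using (Fin; toℕ; fromℕ<)
  open import Data.Fin.Properties using (toℕ-fromℕ<; toℕ-injective; toℕ<n; _≟_)
  open import Data.Fin.Subset using (Subset; _∈_; _∉_; _∪_; _∩_; _─_; _-_; ⁅_⁆; ∁; _⊆_; inside; outside) renaming (⊥ to ∅)
  open import Data.Vec using (_∷_; here; there)
  open import Data.Fin.Subset.Properties using (x∈p∪q⁻; x∈p∪q⁺; x∈⁅y⁆⇔x≡y; x∈⁅y⁆⇒x≡y; x∈⁅x⁆; x∈p∩q⁺; x∈p∩q⁻; ∉⊥; ⊆-antisym;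
    x∈p∧x≢y⇒x∈p-y; x∉p⇒x∈∁p; x∈∁p⇒x∉p; p─q⊆p; x∉⁅y⁆⇒x≢y; _∈?_; ∩-identityʳ; p∪∁p≡⊤; ∩-distribˡ-∪)
  open import Data.Product using (∃; ∃₂; _×_; _,_; proj₁; proj₂)
  open import Data.Sum using (_⊎_; inj₁; inj₂)
  open import Data.Empty using (⊥; ⊥-elim)
  open import Relation.Nullary using (¬_; Dec; yes; no)
  import Relation.Binary.PropositionalEquality as ≡
  open ≡ using (_≡_; _≢_)
  open import Function.Bundles using (_⇔_; mk⇔)
  open Matroid

  x∈p─q⇒x∉q : ∀ {n} {p q : Subset n} {x} → x ∈ p ─ q → x ∉ q
  x∈p─q⇒x∉q {p = _ ∷ p} {outside ∷ q} here ()
  x∈p─q⇒x∉q {p = _ ∷ p} {inside ∷ q} () here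
  x∈p─q⇒x∉q {p = _ ∷ p} {_ ∷ q} (there x∈) (there x∈q) = x∈p─q⇒x∉q x∈ x∈q

  _⟨_↦_⟩ : ∀ {n} → Subset n → Fin n → Fin n → Subset n
  B ⟨ x ↦ y ⟩ = (B - x) ∪ ⁅ y ⁆

  module _ {n} {B : Subset n} {x y : Fin n} where

    ∈-⟨↦⟩⁻ : ∀ {z} → z ∈ B ⟨ x ↦ y ⟩ → (z ∈ B × z ≢ x) ⊎ z ≡ y
    ∈-⟨↦⟩⁻ z∈ with x∈p∪q⁻ (B - x) ⁅ y ⁆ z∈
    ... | inj₁ z∈B-x = inj₁ (p─q⊆p B ⁅ x ⁆ z∈B-x , x∉⁅y⁆⇒x≢y (x∈p─q⇒x∉q z∈B-x))
    ... | inj₂ z∈y = inj₂ (x∈⁅y⁆⇒x≡y y z∈y)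

    ∈-⟨↦⟩⁺ : ∀ {z} → (z ∈ B × z ≢ x) ⊎ z ≡ y → z ∈ B ⟨ x ↦ y ⟩
    ∈-⟨↦⟩⁺ (inj₁ (z∈B , z≢x)) = x∈p∪q⁺ (inj₁ (x∈p∧x≢y⇒x∈p-y z∈B z≢x))
    ∈-⟨↦⟩⁺ (inj₂ ≡.refl) = x∈p∪q⁺ (inj₂ (x∈⁅x⁆ y))

    y∈⟨x↦y⟩ : y ∈ B ⟨ x ↦ y ⟩
    y∈⟨x↦y⟩ = ∈-⟨↦⟩⁺ (inj₂ ≡.refl)

  ⟨↦⟩-∩ : ∀ {n} {B Z : Subset n} {x y} → y ∈ Z → (B ∩ Z) ⟨ x ↦ y ⟩ ≡ B ⟨ x ↦ y ⟩ ∩ Z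
  ⟨↦⟩-∩ {B = B} {Z} {x} {y} y∈Z = ⊆-antisym to from
    where
    to : (B ∩ Z) ⟨ x ↦ y ⟩ ⊆ B ⟨ x ↦ y ⟩ ∩ Z
    to z∈ with ∈-⟨↦⟩⁻ z∈
    ... | inj₁ (z∈B∩Z , z≢x) = let z∈B , z∈Z = x∈p∩q⁻ B Z z∈B∩Z in x∈p∩q⁺ (∈-⟨↦⟩⁺ (inj₁ (z∈B , z≢x)) , z∈Z)
    ... | inj₂ ≡.refl = x∈p∩q⁺ (y∈⟨x↦y⟩ , y∈Z)
    from : B ⟨ x ↦ y ⟩ ∩ Z ⊆ (B ∩ Z) ⟨ x ↦ y ⟩
    from z∈ with x∈p∩q⁻ (B ⟨ x ↦ y ⟩) Z z∈
    ... | z∈B′ , z∈Z with ∈-⟨↦⟩⁻ z∈B′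
    ... | inj₁ (z∈B , z≢x) = ∈-⟨↦⟩⁺ (inj₁ (x∈p∩q⁺ (z∈B , z∈Z) , z≢x))
    ... | inj₂ z≡y = ∈-⟨↦⟩⁺ (inj₂ z≡y)

  ⟨x↦x⟩ : ∀ {n} {B : Subset n} {x} → x ∈ B → B ⟨ x ↦ x ⟩ ≡ B
  ⟨x↦x⟩ {B = B} {x} x∈B = ⊆-antisym to from
    where
    to : B ⟨ x ↦ x ⟩ ⊆ B
    to z∈ with ∈-⟨↦⟩⁻ z∈
    ... | inj₁ (z∈B , _) = z∈B
    ... | inj₂ ≡.refl = x∈B
    from : B ⊆ B ⟨ x ↦ x ⟩
    from {z} z∈B with z ≟ x
    ... | yes z≡x = ∈-⟨↦⟩⁺ (inj₂ z≡x)
    ... | no z≢x = ∈-⟨↦⟩⁺ (inj₁ (z∈B , z≢x))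

  Exchangeable : ∀ {n} → Matroid n → Fin n → Fin n → Set
  Exchangeable N x y = ∃ λ B → IsBasis N B × x ∈ B × y ∉ B × IsBasis N (B ⟨ x ↦ y ⟩)

  module _ {n} {N : Matroid n} where

    exchangeable-sym : ∀ {x y} → Exchangeable N x y → Exchangeable N y x
    exchangeable-sym {x} {y} (B , B-basis , x∈B , y∉B , B′-basis) =
      B ⟨ x ↦ y ⟩ , B′-basis , y∈⟨x↦y⟩ , x∉B′ , ≡.subst (IsBasis N) (≡.sym back) B-basis
      where
      x∉B′ : x ∉ B ⟨ x ↦ y ⟩
      x∉B′ x∈ with ∈-⟨↦⟩⁻ x∈
      ... | inj₁ (_ , x≢x) = x≢x ≡.refl
      ... | inj₂ x≡y = y∉B (≡.subst (_∈ B) x≡y x∈B)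
      back : B ⟨ x ↦ y ⟩ ⟨ y ↦ x ⟩ ≡ B
      back = ⊆-antisym to from
        where
        to : B ⟨ x ↦ y ⟩ ⟨ y ↦ x ⟩ ⊆ B
        to z∈ with ∈-⟨↦⟩⁻ z∈
        ... | inj₂ ≡.refl = x∈B
        ... | inj₁ (z∈′ , z≢y) with ∈-⟨↦⟩⁻ z∈′
        ... | inj₁ (z∈B , _) = z∈B
        ... | inj₂ z≡y = ⊥-elim (z≢y z≡y)
        from : B ⊆ B ⟨ x ↦ y ⟩ ⟨ y ↦ x ⟩
        from {z} z∈B with z ≟ x
        ... | yes z≡x = ∈-⟨↦⟩⁺ (inj₂ z≡x)
        ... | no z≢x = ∈-⟨↦⟩⁺ (inj₁ (∈-⟨↦⟩⁺ (inj₁ (z∈B , z≢x)) , λ { ≡.refl → y∉B z∈B }))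

    exchangeable-≢ : ∀ {x y} → Exchangeable N x y → x ≢ y
    exchangeable-≢ (B , _ , x∈B , y∉B , _) ≡.refl = y∉B x∈B

    exchangeable⇒∈ground : ∀ {x y} → Exchangeable N x y → x ∈ ground N × y ∈ ground N
    exchangeable⇒∈ground (B , B-basis , x∈B , _ , B′-basis) = basis⊆ground N B-basis x∈B , basis⊆ground N B′-basis y∈⟨x↦y⟩

    basis-⊆-basis : ∀ {B C} → IsBasis N B → IsBasis N C → B ⊆ C → C ⊆ B
    basis-⊆-basis {B} B-basis C-basis B⊆C {r} r∈C with r ∈? B
    ... | yes r∈B = r∈B
    ... | no r∉B with exchange N C-basis B-basis r∈C r∉B
    ... | y , y∈B , y∉C , _ = ⊥-elim (y∉C (B⊆C y∈B))

  module Split {n} (N : Matroid n) (X : Subset n) where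

    ExchangeClosed : Subset n → Set
    ExchangeClosed Z = ∀ {x y} → Exchangeable N x y → x ∈ Z → y ∈ Z

    NoExchangeAcross : Set
    NoExchangeAcross = ∀ {x y} → Exchangeable N x y → x ∈ X → y ∉ X → ⊥

    module _ (none : NoExchangeAcross) where

      closed : ExchangeClosed X
      closed {y = y} xy x∈X with y ∈? X
      ... | yes y∈X = y∈X
      ... | no y∉X = ⊥-elim (none xy x∈X y∉X)

      closed-∁ : ExchangeClosed (∁ X)
      closed-∁ {y = y} xy x∈∁X with y ∈? X
      ... | no y∉X = x∉p⇒x∈∁p y∉X
      ... | yes y∈X = ⊥-elim (none (exchangeable-sym {N = N} xy) y∈X (x∈∁p⇒x∉p x∈∁X))

    restrict : (Z : Subset n) → ExchangeClosed Z → Matroid n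
    restrict Z closedZ = record
      { ground = ground N ∩ Z
      ; IsBasis = λ C → ∃ λ B → IsBasis N B × C ≡ B ∩ Z
      ; basis⊆ground = λ { (B , B-basis , ≡.refl) z∈ → let z∈B , z∈Z = x∈p∩q⁻ B Z z∈ in
                                                        x∈p∩q⁺ (basis⊆ground N B-basis z∈B , z∈Z) }
      ; basis-exists = let B , B-basis = basis-exists N in B ∩ Z , B , B-basis , ≡.refl
      ; exchange = exchange∩
      }
      where
      exchange∩ : ∀ {C C′} → (∃ λ B → IsBasis N B × C ≡ B ∩ Z) → (∃ λ B′ → IsBasis N B′ × C′ ≡ B′ ∩ Z) →
                  ∀ {x} → x ∈ C → x ∉ C′ → ∃ λ y → y ∈ C′ × y ∉ C × ∃ λ B″ → IsBasis N B″ × C ⟨ x ↦ y ⟩ ≡ B″ ∩ Z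
      exchange∩ (B , B-basis , ≡.refl) (B′ , B′-basis , ≡.refl) {x} x∈C x∉C′ with x∈p∩q⁻ B Z x∈C
      ... | x∈B , x∈Z with exchange N B-basis B′-basis x∈B (λ x∈B′ → x∉C′ (x∈p∩q⁺ (x∈B′ , x∈Z)))
      ... | y , y∈B′ , y∉B , B″-basis =
        y , x∈p∩q⁺ (y∈B′ , y∈Z) , (λ y∈C → y∉B (proj₁ (x∈p∩q⁻ B Z y∈C))) , B ⟨ x ↦ y ⟩ , B″-basis , ⟨↦⟩-∩ y∈Z
        where
        y∈Z : y ∈ Z
        y∈Z = closedZ (B , B-basis , x∈B , y∉B , B″-basis) x∈Z

    -- Sweep the positions 0, 1, … of C = B′, trading each element of C ∩ X outside B for one of B.
    module Mixing (closedX : ExchangeClosed X) {B B′ : Subset n} (B-basis : IsBasis N B) (B′-basis : IsBasis N B′) where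

      Sweep : ℕ → Subset n → Set
      Sweep k C = IsBasis N C × (∀ {z} → z ∉ X → z ∈ C → z ∈ B′) × (∀ {z} → z ∉ X → z ∈ B′ → z ∈ C) ×
                  (∀ {z} → toℕ z ℕ.< k → z ∈ C → z ∈ X → z ∈ B)

      sweep-step : ∀ {k} C → Sweep k C → k ℕ.< n → ∃ (Sweep (suc k))
      sweep-step {k} C (C-basis , off-X⊆B′ , B′⊆off-X , below⊆B) k<n = go (z₀ ∈? C) (z₀ ∈? X) (z₀ ∈? B)
        where
        z₀ : Fin n
        z₀ = fromℕ< k<n
        below : ∀ {z} → toℕ z ℕ.< suc k → z ≢ z₀ → toℕ z ℕ.< k
        below z<k+1 z≢z₀ = ℕ.≤∧≢⇒< (ℕ.≤-pred z<k+1) (λ z≡k → z≢z₀ (toℕ-injective (≡.trans z≡k (≡.sym (toℕ-fromℕ< k<n)))))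
        keep : (z₀ ∈ C → z₀ ∈ X → z₀ ∈ B) → ∃ (Sweep (suc k))
        keep at-z₀ = C , C-basis , off-X⊆B′ , B′⊆off-X , extend
          where
          extend : ∀ {z} → toℕ z ℕ.< suc k → z ∈ C → z ∈ X → z ∈ B
          extend {z} z<k+1 z∈C z∈X with z ≟ z₀
          ... | yes ≡.refl = at-z₀ z∈C z∈X
          ... | no z≢z₀ = below⊆B (below z<k+1 z≢z₀) z∈C z∈X
        trade : z₀ ∈ C → z₀ ∈ X → z₀ ∉ B → ∃ (Sweep (suc k))
        trade z₀∈C z₀∈X z₀∉B with exchange N C-basis B-basis z₀∈C z₀∉B
        ... | y , y∈B , y∉C , C′-basis = C ⟨ z₀ ↦ y ⟩ , C′-basis , off-X⊆B′₁ , B′⊆off-X₁ , below⊆B₁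
          where
          y∈X : y ∈ X
          y∈X = closedX (C , C-basis , z₀∈C , y∉C , C′-basis) z₀∈X
          off-X⊆B′₁ : ∀ {z} → z ∉ X → z ∈ C ⟨ z₀ ↦ y ⟩ → z ∈ B′
          off-X⊆B′₁ z∉X z∈ with ∈-⟨↦⟩⁻ z∈
          ... | inj₁ (z∈C , _) = off-X⊆B′ z∉X z∈C
          ... | inj₂ ≡.refl = ⊥-elim (z∉X y∈X)
          B′⊆off-X₁ : ∀ {z} → z ∉ X → z ∈ B′ → z ∈ C ⟨ z₀ ↦ y ⟩
          B′⊆off-X₁ z∉X z∈B′ = ∈-⟨↦⟩⁺ (inj₁ (B′⊆off-X z∉X z∈B′ , λ { ≡.refl → z∉X z₀∈X }))
          below⊆B₁ : ∀ {z} → toℕ z ℕ.< suc k → z ∈ C ⟨ z₀ ↦ y ⟩ → z ∈ X → z ∈ B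
          below⊆B₁ z<k+1 z∈ z∈X with ∈-⟨↦⟩⁻ z∈
          ... | inj₁ (z∈C , z≢z₀) = below⊆B (below z<k+1 z≢z₀) z∈C z∈X
          ... | inj₂ ≡.refl = y∈B
        go : Dec (z₀ ∈ C) → Dec (z₀ ∈ X) → Dec (z₀ ∈ B) → ∃ (Sweep (suc k))
        go (no z₀∉C) _ _ = keep (λ z₀∈C _ → ⊥-elim (z₀∉C z₀∈C))
        go (yes _) (no z₀∉X) _ = keep (λ _ z₀∈X → ⊥-elim (z₀∉X z₀∈X))
        go (yes _) (yes _) (yes z₀∈B) = keep (λ _ _ → z₀∈B)
        go (yes z₀∈C) (yes z₀∈X) (no z₀∉B) = trade z₀∈C z₀∈X z₀∉B

      sweep : ∀ k → k ℕ.≤ n → ∃ (Sweep k)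
      sweep zero _ = B′ , B′-basis , (λ _ z∈ → z∈) , (λ _ z∈ → z∈) , λ ()
      sweep (suc k) k<n = let C , C-sweep = sweep k (ℕ.<⇒≤ k<n) in sweep-step C C-sweep k<n

      basis-mix : IsBasis N ((B ∩ X) ∪ (B′ ∩ ∁ X))
      basis-mix with sweep n ℕ.≤-refl
      ... | C , C-basis , off-X⊆B′ , B′⊆off-X , X⊆B = ≡.subst (IsBasis N) (⊆-antisym to from) C-basis
        where
        to : C ⊆ (B ∩ X) ∪ (B′ ∩ ∁ X)
        to {z} z∈C with z ∈? X
        ... | yes z∈X = x∈p∪q⁺ (inj₁ (x∈p∩q⁺ (X⊆B (toℕ<n z) z∈C z∈X , z∈X)))
        ... | no z∉X = x∈p∪q⁺ (inj₂ (x∈p∩q⁺ (off-X⊆B′ z∉X z∈C , x∉p⇒x∈∁p z∉X)))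
        from : (B ∩ X) ∪ (B′ ∩ ∁ X) ⊆ C
        from {z} z∈ with x∈p∪q⁻ (B ∩ X) (B′ ∩ ∁ X) z∈
        ... | inj₂ z∈B′∖X = let z∈B′ , z∈∁X = x∈p∩q⁻ B′ (∁ X) z∈B′∖X in B′⊆off-X (x∈∁p⇒x∉p z∈∁X) z∈B′
        ... | inj₁ z∈B∩X with x∈p∩q⁻ B X z∈B∩X | z ∈? C
        ... | _ | yes z∈C = z∈C
        ... | z∈B , z∈X | no z∉C with exchange N B-basis C-basis z∈B z∉C
        ... | y , y∈C , y∉B , B″-basis = ⊥-elim (y∉B (X⊆B (toℕ<n y) y∈C (closedX (B , B-basis , z∈B , y∉B , B″-basis) z∈X)))

    split-by : (B : Subset n) → B ≡ (B ∩ X) ∪ (B ∩ ∁ X)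
    split-by B = ≡.trans (≡.sym (∩-identityʳ B)) (≡.trans (≡.cong (B ∩_) (≡.sym (p∪∁p≡⊤ X))) (∩-distribˡ-∪ B X (∁ X)))

    decompose : (none : NoExchangeAcross) → IsDirectSum N (restrict X (closed none)) (restrict (∁ X) (closed-∁ none))
    decompose none = disjoint , split-by (ground N) , bases
      where
      disjoint : (ground N ∩ X) ∩ (ground N ∩ ∁ X) ≡ ∅
      disjoint = ⊆-antisym (λ z∈ → let z∈X , z∈∁X = in-both z∈ in ⊥-elim (x∈∁p⇒x∉p z∈∁X z∈X)) (λ z∈∅ → ⊥-elim (∉⊥ z∈∅))
        where
        in-both : ∀ {z} → z ∈ (ground N ∩ X) ∩ (ground N ∩ ∁ X) → z ∈ X × z ∈ ∁ X
        in-both z∈ = let z∈GX , z∈G∁X = x∈p∩q⁻ _ _ z∈ in proj₂ (x∈p∩q⁻ _ _ z∈GX) , proj₂ (x∈p∩q⁻ _ _ z∈G∁X)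
      bases : ∀ B → IsBasis N B ⇔ (∃₂ λ B₁ B₂ → IsBasis (restrict X (closed none)) B₁ ×
                                                IsBasis (restrict (∁ X) (closed-∁ none)) B₂ × B ≡ B₁ ∪ B₂)
      bases B = mk⇔ (λ B-basis → B ∩ X , B ∩ ∁ X , (B , B-basis , ≡.refl) , (B , B-basis , ≡.refl) , split-by B)
                    (λ { (_ , _ , (B₁ , B₁-basis , ≡.refl) , (B₂ , B₂-basis , ≡.refl) , ≡.refl) →
                         Mixing.basis-mix (closed none) B₁-basis B₂-basis })

    connected⇒exchange-across : Connected N → (∃ λ x → x ∈ ground N × x ∈ X) → (∃ λ y → y ∈ ground N × y ∉ X) →
                                ¬ ¬ (∃₂ λ x y → Exchangeable N x y × x ∈ X × y ∉ X)
    connected⇒exchange-across connected (x , x∈G , x∈X) (y , y∈G , y∉X) no-exchange =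
      connected (restrict X (closed none) , restrict (∁ X) (closed-∁ none) ,
                 (x , x∈p∩q⁺ (x∈G , x∈X)) , (y , x∈p∩q⁺ (y∈G , x∉p⇒x∈∁p y∉X)) , decompose none)
      where
      none : NoExchangeAcross
      none xy x∈X y∉X = no-exchange (_ , _ , xy , x∈X , y∉X)

module CyclicIntervals where

  open import Data.Nat as ℕ using (ℕ; zero; suc; z≤n; s≤s)
  import Data.Nat.Properties as ℕ
  open import Data.Fin using (Fin; zero; suc; toℕ; inject₁; fromℕ<) renaming (_<_ to _<ᶠ_; _≤_ to _≤ᶠ_)
  open import Data.Fin.Properties using (toℕ-injective; toℕ-inject₁; toℕ-fromℕ<; toℕ<n; ≤∧≢⇒<)
  open import Data.Fin.Subset using (Subset; _∈_; _∉_; Nonempty; inside; outside)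
  open import Data.Fin.Subset.Properties using (_∈?_; nonempty?)
  open import Data.Vec using (_∷_; here; there)
  open import Data.Product using (∃; ∃₂; _×_; _,_)
  open import Data.Sum using (_⊎_; inj₁; inj₂; swap)
  open import Data.Empty using (⊥; ⊥-elim)
  open import Relation.Nullary using (yes; no)
  import Relation.Binary.PropositionalEquality as ≡
  open ≡ using (_≡_; _≢_)
  open import Function.Bundles using (_⇔_; Equivalence; mk⇔)

  least : ∀ {n} (E : Subset n) → Nonempty E → ∃ λ i → i ∈ E × (∀ {k} → k ∈ E → i ≤ᶠ k)
  least (inside ∷ E) _ = zero , here , λ _ → z≤n
  least (outside ∷ E) (suc x , there x∈E) with least E (x , x∈E)
  ... | i , i∈E , i≤ = suc i , there i∈E , λ { (there k∈E) → s≤s (i≤ k∈E) }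

  greatest : ∀ {n} (E : Subset n) → Nonempty E → ∃ λ j → j ∈ E × (∀ {k} → k ∈ E → k ≤ᶠ j)
  greatest (b ∷ E) nonempty with nonempty? E
  ... | yes nonempty′ with greatest E nonempty′
  ...   | j , j∈E , ≤j = suc j , there j∈E , λ { {zero} _ → z≤n ; {suc k} (there k∈E) → s≤s (≤j k∈E) }
  greatest (inside ∷ E) _ | no empty = zero , here , λ { {zero} _ → z≤n ; {suc k} (there k∈E) → ⊥-elim (empty (k , k∈E)) }
  greatest (outside ∷ E) (zero , ()) | no empty
  greatest (outside ∷ E) (suc k , there k∈E) | no empty = ⊥-elim (empty (k , k∈E))

  NoAlternation : ∀ {n} → Subset n → Subset n → Set
  NoAlternation A B = ∀ {a b c d} → a <ᶠ b → b <ᶠ c → c <ᶠ d → a ∈ A → b ∈ B → c ∈ A → d ∈ B → ⊥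

  module _ {m} {E E′ : Subset (suc m)} (covers : ∀ z → z ∈ E ⊎ z ∈ E′) (0∉E : zero ∉ E)
           (no-alternation : NoAlternation E′ E) where

    interval-of-nonalternating : Nonempty E → ∃₂ λ i j → 0 ℕ.< toℕ i × i ≤ᶠ j × (∀ k → k ∈ E ⇔ (i ≤ᶠ k × k ≤ᶠ j))
    interval-of-nonalternating nonempty with least E nonempty | greatest E nonempty
    ... | i , i∈E , i≤ | j , j∈E , ≤j =
      i , j , 0<i , i≤ j∈E , λ k → mk⇔ (λ k∈E → i≤ k∈E , ≤j k∈E) (λ (i≤k , k≤j) → filled i≤k k≤j)
      where
      0<i : 0 ℕ.< toℕ i
      0<i with toℕ i ℕ.≟ 0
      ... | yes i≡0 = ⊥-elim (0∉E (≡.subst (_∈ E) (toℕ-injective i≡0) i∈E))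
      ... | no i≢0 = ℕ.n≢0⇒n>0 i≢0
      filled : ∀ {k} → i ≤ᶠ k → k ≤ᶠ j → k ∈ E
      filled {k} i≤k k≤j with k ∈? E | covers k
      ... | yes k∈E | _ = k∈E
      ... | no k∉E | inj₁ k∈E = ⊥-elim (k∉E k∈E)
      ... | no k∉E | inj₂ k∈E′ with covers zero
      ...   | inj₁ 0∈E = ⊥-elim (0∉E 0∈E)
      ...   | inj₂ 0∈E′ = ⊥-elim (no-alternation 0<i (≤∧≢⇒< i≤k (λ { ≡.refl → k∉E i∈E })) (≤∧≢⇒< k≤j (λ { ≡.refl → k∉E j∈E }))
                                                  0∈E′ i∈E k∈E′ j∈E)

  InCyclicInterval : ∀ {n} → Fin n → Fin n → Fin n → Set
  InCyclicInterval i j k = (i ≤ᶠ j × i ≤ᶠ k × k ≤ᶠ j) ⊎ (j <ᶠ i × (i ≤ᶠ k ⊎ k ≤ᶠ j))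

  interval⇒cyclicInterval : ∀ {n} {E : Subset n} {i j : Fin n} → i ≤ᶠ j → (∀ k → k ∈ E ⇔ (i ≤ᶠ k × k ≤ᶠ j)) → CyclicInterval E
  interval⇒cyclicInterval {i = i} {j} i≤j E⇔ = i , j , λ k →
    mk⇔ (λ k∈E → inj₁ (i≤j , Equivalence.to (E⇔ k) k∈E))
        (λ { (inj₁ (_ , i≤k , k≤j)) → Equivalence.from (E⇔ k) (i≤k , k≤j) ; (inj₂ (j<i , _)) → ⊥-elim (ℕ.<⇒≱ j<i i≤j) })

  -- The complement wraps around from j + 1 to i - 1, or is [0, i - 1] when j is the last position.
  cointerval⇒cyclicInterval : ∀ {m} {E : Subset (suc m)} {i j : Fin (suc m)} → 0 ℕ.< toℕ i → i ≤ᶠ j →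
                              (∀ k → k ∈ E ⇔ (k <ᶠ i ⊎ j <ᶠ k)) → CyclicInterval E
  cointerval⇒cyclicInterval {m} {E} {suc i′} {j} _ i≤j E⇔ with toℕ j ℕ.≟ m
  ... | yes j≡m = zero , inject₁ i′ , λ k → mk⇔ (to k) (from k)
    where
    to : ∀ k → k ∈ E → InCyclicInterval zero (inject₁ i′) k
    to k k∈E with Equivalence.to (E⇔ k) k∈E
    ... | inj₁ (s≤s k≤i′) = inj₁ (z≤n , z≤n , ≡.subst (toℕ k ℕ.≤_) (≡.sym (toℕ-inject₁ i′)) k≤i′)
    ... | inj₂ j<k = ⊥-elim (ℕ.<⇒≱ j<k (≡.subst (toℕ k ℕ.≤_) (≡.sym j≡m) (ℕ.≤-pred (toℕ<n k))))
    from : ∀ k → InCyclicInterval zero (inject₁ i′) k → k ∈ E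
    from k (inj₁ (_ , _ , k≤i′)) = Equivalence.from (E⇔ k) (inj₁ (s≤s (≡.subst (toℕ k ℕ.≤_) (toℕ-inject₁ i′) k≤i′)))
    from k (inj₂ (() , _))
  ... | no j≢m = j+1 , inject₁ i′ , λ k → mk⇔ (to k) (from k)
    where
    j+1<m+1 : suc (toℕ j) ℕ.< suc m
    j+1<m+1 = s≤s (ℕ.≤∧≢⇒< (ℕ.≤-pred (toℕ<n j)) j≢m)
    j+1 : Fin (suc m)
    j+1 = fromℕ< j+1<m+1
    wraps : inject₁ i′ <ᶠ j+1
    wraps = ≡.subst₂ ℕ._<_ (≡.sym (toℕ-inject₁ i′)) (≡.sym (toℕ-fromℕ< j+1<m+1)) (s≤s (ℕ.<⇒≤ i≤j))
    to : ∀ k → k ∈ E → InCyclicInterval j+1 (inject₁ i′) k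
    to k k∈E with Equivalence.to (E⇔ k) k∈E
    ... | inj₁ (s≤s k≤i′) = inj₂ (wraps , inj₂ (≡.subst (toℕ k ℕ.≤_) (≡.sym (toℕ-inject₁ i′)) k≤i′))
    ... | inj₂ j<k = inj₂ (wraps , inj₁ (≡.subst (ℕ._≤ toℕ k) (≡.sym (toℕ-fromℕ< j+1<m+1)) j<k))
    from : ∀ k → InCyclicInterval j+1 (inject₁ i′) k → k ∈ E
    from k (inj₁ (i≤j′ , _)) = ⊥-elim (ℕ.<⇒≱ wraps i≤j′)
    from k (inj₂ (_ , inj₁ j+1≤k)) = Equivalence.from (E⇔ k) (inj₂ (≡.subst (ℕ._≤ toℕ k) (toℕ-fromℕ< j+1<m+1) j+1≤k))
    from k (inj₂ (_ , inj₂ k≤i′)) = Equivalence.from (E⇔ k) (inj₁ (s≤s (≡.subst (toℕ k ℕ.≤_) (toℕ-inject₁ i′) k≤i′)))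

  nonalternating⇒cyclicInterval : ∀ {n} {E₁ E₂ : Subset n} → (∀ z → z ∈ E₁ ⊎ z ∈ E₂) → (∀ {z} → z ∈ E₁ → z ∉ E₂) →
                                  Nonempty E₁ → Nonempty E₂ → NoAlternation E₁ E₂ → NoAlternation E₂ E₁ → CyclicInterval E₁
  nonalternating⇒cyclicInterval {zero} _ _ (() , _) _ _ _
  nonalternating⇒cyclicInterval {suc m} {E₁} {E₂} covers disjoint nonempty₁ nonempty₂ no-alt₁₂ no-alt₂₁ with zero ∈? E₁
  ... | no 0∉E₁ with interval-of-nonalternating covers 0∉E₁ no-alt₂₁ nonempty₁
  ...   | _ , _ , _ , i≤j , E₁⇔ = interval⇒cyclicInterval i≤j E₁⇔
  nonalternating⇒cyclicInterval {suc m} {E₁} {E₂} covers disjoint nonempty₁ nonempty₂ no-alt₁₂ no-alt₂₁ | yes 0∈E₁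
    with interval-of-nonalternating (λ z → swap (covers z)) (disjoint 0∈E₁) no-alt₁₂ nonempty₂
  ... | i , j , 0<i , i≤j , E₂⇔ = cointerval⇒cyclicInterval 0<i i≤j λ k → mk⇔ (to k) (from k)
    where
    to : ∀ k → k ∈ E₁ → k <ᶠ i ⊎ j <ᶠ k
    to k k∈E₁ with toℕ k ℕ.<? toℕ i | toℕ j ℕ.<? toℕ k
    ... | yes k<i | _ = inj₁ k<i
    ... | no _ | yes j<k = inj₂ j<k
    ... | no k≮i | no j≮k = ⊥-elim (disjoint k∈E₁ (Equivalence.from (E₂⇔ k) (ℕ.≮⇒≥ k≮i , ℕ.≮⇒≥ j≮k)))
    from : ∀ k → k <ᶠ i ⊎ j <ᶠ k → k ∈ E₁
    from k off with covers k
    ... | inj₁ k∈E₁ = k∈E₁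
    ... | inj₂ k∈E₂ with Equivalence.to (E₂⇔ k) k∈E₂ | off
    ...   | i≤k , _ | inj₁ k<i = ⊥-elim (ℕ.<⇒≱ k<i i≤k)
    ...   | _ , k≤j | inj₂ j<k = ⊥-elim (ℕ.<⇒≱ j<k k≤j)

module PositroidDirectSums {c ℓ} (F : OrderedField c ℓ) where

  open import Data.Bool.Properties using (T-≡)
  open import Data.Fin using (Fin) renaming (_<_ to _<ᶠ_)
  open import Data.Fin.Properties using (_<?_; <-cmp; <-trans; <-asym; _≟_)
  open import Data.Fin.Subset using (Subset; _∈_; _∉_; _∪_; _-_; ⁅_⁆; ⊤; _⊆_)
  open import Data.Fin.Subset.Properties
    using (x∈p∪q⁺; x∈p∪q⁻; x∈p∩q⁺; ∉⊥; x∈⁅x⁆; ∈⊤; p─q⊆p; x∈p∧x≢y⇒x∈p-y; ∩-comm; ∪-comm; ∪-commutativeMonoid)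
  open import Data.Vec using (tabulate)
  open import Data.Vec.Properties using ([]=⇒lookup; lookup⇒[]=; lookup∘tabulate)
  open import Data.Product using (∃₂; _×_; _,_; proj₁; proj₂)
  open import Data.Sum using (_⊎_; inj₁; inj₂)
  open import Data.Empty using (⊥; ⊥-elim)
  open import Relation.Nullary using (¬_; Dec; isYes; yes; no)
  open import Function using (_∘_)
  open import Relation.Nullary.Decidable using (_×-dec_; toWitness; fromWitness)
  open import Relation.Binary.Definitions using (tri<; tri≈; tri>)
  import Relation.Binary.PropositionalEquality as ≡
  open ≡ using (_≡_; _≢_)
  open import Function.Bundles using (Equivalence; mk⇔)
  import Algebra.Solver.CommutativeMonoid
  open Matroid
  open MatroidDecomposition
  open PositroidExchange F using (positroid-exchange; _∪⁅_,_⁆; ∈-∪⁅,⁆⁺)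
  open CyclicIntervals using (nonalternating⇒cyclicInterval)

  isDirectSum-comm : ∀ {n} {M N₁ N₂ : Matroid n} → IsDirectSum M N₁ N₂ → IsDirectSum M N₂ N₁
  isDirectSum-comm {N₁ = N₁} {N₂} (disjoint , ground≡ , bases) =
    ≡.trans (∩-comm (ground N₂) (ground N₁)) disjoint ,
    ≡.trans ground≡ (∪-comm (ground N₁) (ground N₂)) ,
    λ B → mk⇔ (λ B-basis → let B₁ , B₂ , b₁ , b₂ , B≡ = Equivalence.to (bases B) B-basis
                            in B₂ , B₁ , b₂ , b₁ , ≡.trans B≡ (∪-comm B₁ B₂))
              (λ { (B₂ , B₁ , b₂ , b₁ , B≡) → Equivalence.from (bases B) (B₁ , B₂ , b₁ , b₂ , ≡.trans B≡ (∪-comm B₂ B₁)) })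

  module _ {n} {M N₁ N₂ : Matroid n} (sum : IsDirectSum M N₁ N₂) where

    disjoint : ∀ {x} → x ∈ ground N₁ → x ∉ ground N₂
    disjoint x∈₁ x∈₂ = ∉⊥ (≡.subst (_ ∈_) (proj₁ sum) (x∈p∩q⁺ (x∈₁ , x∈₂)))

    ground≡⊤⇒covers : ground M ≡ ⊤ → ∀ x → x ∈ ground N₁ ⊎ x ∈ ground N₂
    ground≡⊤⇒covers ground≡⊤ x = x∈p∪q⁻ _ _ (≡.subst (x ∈_) (≡.trans (≡.sym ground≡⊤) (proj₁ (proj₂ sum))) ∈⊤)

  -- Put S = (B₁ - p) ∪ (B₂ - q); then S ∪ {q, r} and S ∪ {p, s} are bases of M, while a basis S ∪ {p, r}
  -- would have an N₁-part strictly containing B₁.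
  module CrossingExchanges {n} {M N₁ N₂ : Matroid n} (sum : IsDirectSum M N₁ N₂) {p q r s : Fin n}
    {B₁} (B₁-basis : IsBasis N₁ B₁) (p∈B₁ : p ∈ B₁) (r∉B₁ : r ∉ B₁) (B₁′-basis : IsBasis N₁ (B₁ ⟨ p ↦ r ⟩))
    {B₂} (B₂-basis : IsBasis N₂ B₂) (q∈B₂ : q ∈ B₂) (s∉B₂ : s ∉ B₂) (B₂′-basis : IsBasis N₂ (B₂ ⟨ q ↦ s ⟩)) where

    S : Subset n
    S = (B₁ - p) ∪ (B₂ - q)

    private
      not-in-S : ∀ {x} → x ∉ B₁ - p → x ∉ B₂ - q → x ∉ S
      not-in-S x∉₁ x∉₂ x∈S with x∈p∪q⁻ (B₁ - p) (B₂ - q) x∈S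
      ... | inj₁ x∈₁ = x∉₁ x∈₁
      ... | inj₂ x∈₂ = x∉₂ x∈₂
      apart : ∀ {x} → x ∈ ground N₁ → x ∉ ground N₂
      apart = disjoint {M = M} {N₁} {N₂} sum
      minus-self : ∀ {B : Subset n} {x} → x ∉ B - x
      minus-self x∈ = x∈p─q⇒x∉q x∈ (x∈⁅x⁆ _)
      basis-of-sum : ∀ {B C} → IsBasis N₁ B → IsBasis N₂ C → IsBasis M (B ∪ C)
      basis-of-sum B-basis C-basis = Equivalence.from (proj₂ (proj₂ sum) _) (_ , _ , B-basis , C-basis , ≡.refl)
      module ∪-Solver = Algebra.Solver.CommutativeMonoid (∪-commutativeMonoid n)
      open ∪-Solver using (_⊕_; _⊜_)

    p∉S : p ∉ S
    p∉S = not-in-S minus-self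
      (λ p∈ → apart (basis⊆ground N₁ B₁-basis p∈B₁) (basis⊆ground N₂ B₂-basis (p─q⊆p _ _ p∈)))

    q∉S : q ∉ S
    q∉S = not-in-S (λ q∈ → apart (basis⊆ground N₁ B₁-basis (p─q⊆p _ _ q∈)) (basis⊆ground N₂ B₂-basis q∈B₂))
      minus-self

    r∉S : r ∉ S
    r∉S = not-in-S (λ r∈ → r∉B₁ (p─q⊆p _ _ r∈))
      (λ r∈ → apart (basis⊆ground N₁ B₁′-basis y∈⟨x↦y⟩) (basis⊆ground N₂ B₂-basis (p─q⊆p _ _ r∈)))

    s∉S : s ∉ S
    s∉S = not-in-S (λ s∈ → apart (basis⊆ground N₁ B₁-basis (p─q⊆p _ _ s∈)) (basis⊆ground N₂ B₂′-basis y∈⟨x↦y⟩))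
      (λ s∈ → s∉B₂ (p─q⊆p _ _ s∈))

    Sqr-basis : IsBasis M (S ∪⁅ q , r ⁆)
    Sqr-basis = ≡.subst (IsBasis M) (≡.sym (≡.trans regroup (≡.cong (_ ∪_) (⟨x↦x⟩ q∈B₂))))
                        (basis-of-sum B₁′-basis B₂-basis)
      where
      regroup : S ∪⁅ q , r ⁆ ≡ ((B₁ - p) ∪ ⁅ r ⁆) ∪ ((B₂ - q) ∪ ⁅ q ⁆)
      regroup = ∪-Solver.solve 4 (λ x y a b → (x ⊕ y) ⊕ (a ⊕ b) ⊜ (x ⊕ b) ⊕ (y ⊕ a)) ≡.refl _ _ _ _

    Sps-basis : IsBasis M (S ∪⁅ p , s ⁆)
    Sps-basis = ≡.subst (IsBasis M) (≡.sym (≡.trans regroup (≡.cong (_∪ _) (⟨x↦x⟩ p∈B₁))))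
                        (basis-of-sum B₁-basis B₂′-basis)
      where
      regroup : S ∪⁅ p , s ⁆ ≡ ((B₁ - p) ∪ ⁅ p ⁆) ∪ ((B₂ - q) ∪ ⁅ s ⁆)
      regroup = ∪-Solver.solve 4 (λ x y a b → (x ⊕ y) ⊕ (a ⊕ b) ⊜ (x ⊕ a) ⊕ (y ⊕ b)) ≡.refl _ _ _ _

    Spr-not-basis : ¬ IsBasis M (S ∪⁅ p , r ⁆)
    Spr-not-basis Spr with Equivalence.to (proj₂ (proj₂ sum) _) Spr
    ... | D₁ , D₂ , D₁-basis , D₂-basis , Spr≡ = r∉B₁ (basis-⊆-basis {N = N₁} B₁-basis D₁-basis B₁⊆D₁ r∈D₁)
      where
      in-D₁ : ∀ {z} → z ∈ ground N₁ → z ∈ S ∪⁅ p , r ⁆ → z ∈ D₁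
      in-D₁ z∈E₁ z∈ with x∈p∪q⁻ D₁ D₂ (≡.subst (_ ∈_) Spr≡ z∈)
      ... | inj₁ z∈D₁ = z∈D₁
      ... | inj₂ z∈D₂ = ⊥-elim (apart z∈E₁ (basis⊆ground N₂ D₂-basis z∈D₂))
      B₁⊆D₁ : B₁ ⊆ D₁
      B₁⊆D₁ {z} z∈B₁ with z ≟ p
      ... | yes ≡.refl = in-D₁ (basis⊆ground N₁ B₁-basis p∈B₁) (∈-∪⁅,⁆⁺ (inj₂ (inj₁ ≡.refl)))
      ... | no z≢p = in-D₁ (basis⊆ground N₁ B₁-basis z∈B₁) (∈-∪⁅,⁆⁺ (inj₁ (x∈p∪q⁺ (inj₁ (x∈p∧x≢y⇒x∈p-y z∈B₁ z≢p)))))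
      r∈D₁ : r ∈ D₁
      r∈D₁ = in-D₁ (basis⊆ground N₁ B₁′-basis y∈⟨x↦y⟩) (∈-∪⁅,⁆⁺ (inj₂ (inj₂ ≡.refl)))

  no-crossing-exchanges : ∀ {n} {M N₁ N₂ : Matroid n} → ground M ≡ ⊤ → IsPositroid F M → IsDirectSum M N₁ N₂ →
                          ∀ {p q r s} → Exchangeable N₁ p r → Exchangeable N₂ q s → p <ᶠ q → q <ᶠ r → r <ᶠ s → ⊥
  no-crossing-exchanges {M = M} {N₁} {N₂} ground≡⊤ positroid sum (_ , B₁-basis , p∈B₁ , r∉B₁ , B₁′-basis)
                        (_ , B₂-basis , q∈B₂ , s∉B₂ , B₂′-basis) p<q q<r r<s =
    Spr-not-basis (positroid-exchange M ground≡⊤ positroid S p<q q<r r<s p∉S q∉S r∉S s∉S Sqr-basis Sps-basis)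
    where open CrossingExchanges {M = M} {N₁} {N₂} sum B₁-basis p∈B₁ r∉B₁ B₁′-basis B₂-basis q∈B₂ s∉B₂ B₂′-basis

  strictlyBetween? : ∀ {n} (lo hi z : Fin n) → Dec (lo <ᶠ z × z <ᶠ hi)
  strictlyBetween? lo hi z = (lo <? z) ×-dec (z <? hi)

  between : ∀ {n} → Fin n → Fin n → Subset n
  between lo hi = tabulate (isYes ∘ strictlyBetween? lo hi)

  module _ {n} {lo hi z : Fin n} where

    ∈-between⁻ : z ∈ between lo hi → lo <ᶠ z × z <ᶠ hi
    ∈-between⁻ z∈ = toWitness {a? = strictlyBetween? lo hi z}
      (Equivalence.from T-≡ (≡.trans (≡.sym (lookup∘tabulate (isYes ∘ strictlyBetween? lo hi) z)) ([]=⇒lookup z∈)))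

    ∈-between⁺ : lo <ᶠ z → z <ᶠ hi → z ∈ between lo hi
    ∈-between⁺ lo<z z<hi = lookup⇒[]= z _
      (≡.trans (lookup∘tabulate (isYes ∘ strictlyBetween? lo hi) z) (Equivalence.to T-≡ (fromWitness (lo<z , z<hi))))

  module Interleaving {n} {M N₁ N₂ : Matroid n} (ground≡⊤ : ground M ≡ ⊤) (positroid : IsPositroid F M)
    (sum : IsDirectSum M N₁ N₂) (connected₁ : Connected N₁) (connected₂ : Connected N₂) where

    private
      apart : ∀ {x y} → x ∈ ground N₁ → y ∈ ground N₂ → x ≢ y
      apart x∈₁ y∈₂ ≡.refl = disjoint {M = M} {N₁} {N₂} sum x∈₁ y∈₂
      cross₁₂ : ∀ {p q r s} → Exchangeable N₁ p r → Exchangeable N₂ q s → p <ᶠ q → q <ᶠ r → r <ᶠ s → ⊥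
      cross₁₂ = no-crossing-exchanges {M = M} {N₁} {N₂} ground≡⊤ positroid sum
      cross₂₁ : ∀ {p q r s} → Exchangeable N₂ p r → Exchangeable N₁ q s → p <ᶠ q → q <ᶠ r → r <ᶠ s → ⊥
      cross₂₁ = no-crossing-exchanges {M = M} {N₂} {N₁} ground≡⊤ positroid (isDirectSum-comm {M = M} {N₁} {N₂} sum)

    -- An exchange of N₂ leaving the interval (x, y) would cross the exchange x ↦ y of N₁.
    exchange-confines : ∀ {x y w o} → Exchangeable N₁ x y → x <ᶠ y → w ∈ ground N₂ → o ∈ ground N₂ →
                        w ∈ between x y → o ∉ between x y → ⊥
    exchange-confines {x} {y} {w} {o} xy x<y w∈₂ o∈₂ w∈ o∉ =
      Split.connected⇒exchange-across N₂ (between x y) connected₂ (w , w∈₂ , w∈) (o , o∈₂ , o∉) crossing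
      where
      crossing : ¬ (∃₂ λ u v → Exchangeable N₂ u v × u ∈ between x y × v ∉ between x y)
      crossing (u , v , uv , u∈ , v∉) with ∈-between⁻ u∈ | exchangeable⇒∈ground {N = N₂} uv | exchangeable⇒∈ground {N = N₁} xy
      ... | x<u , u<y | u∈₂ , v∈₂ | x∈₁ , y∈₁ with <-cmp v x
      ... | tri< v<x _ _ = cross₂₁ (exchangeable-sym {N = N₂} uv) xy v<x x<u u<y
      ... | tri≈ _ v≡x _ = apart x∈₁ v∈₂ (≡.sym v≡x)
      ... | tri> _ _ x<v with <-cmp v y
      ...   | tri< v<y _ _ = v∉ (∈-between⁺ x<v v<y)
      ...   | tri≈ _ v≡y _ = apart y∈₁ v∈₂ (≡.sym v≡y)
      ...   | tri> _ _ y<v = cross₁₂ xy uv x<u u<y y<v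

    no-alternation : ∀ {a b c d} → a <ᶠ b → b <ᶠ c → c <ᶠ d →
                     a ∈ ground N₁ → b ∈ ground N₂ → c ∈ ground N₁ → d ∈ ground N₂ → ⊥
    no-alternation {a} {b} {c} {d} a<b b<c c<d a∈₁ b∈₂ c∈₁ d∈₂ =
      Split.connected⇒exchange-across N₁ (between b d) connected₁
        (c , c∈₁ , ∈-between⁺ b<c c<d) (a , a∈₁ , λ a∈ → <-asym (proj₁ (∈-between⁻ a∈)) a<b) leaving
      where
      leaving : ¬ (∃₂ λ x y → Exchangeable N₁ x y × x ∈ between b d × y ∉ between b d)
      leaving (x , y , xy , x∈ , y∉) with ∈-between⁻ x∈ | exchangeable⇒∈ground {N = N₁} xy
      ... | b<x , x<d | _ , y∈₁ with <-cmp x y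
      ... | tri≈ _ x≡y _ = exchangeable-≢ {N = N₁} xy x≡y
      ... | tri< x<y _ _ = exchange-confines xy x<y d∈₂ b∈₂ (∈-between⁺ x<d d<y) (λ b∈ → <-asym (proj₁ (∈-between⁻ b∈)) b<x)
        where
        d<y : d <ᶠ y
        d<y with <-cmp d y
        ... | tri< d<y _ _ = d<y
        ... | tri≈ _ d≡y _ = ⊥-elim (apart y∈₁ d∈₂ (≡.sym d≡y))
        ... | tri> _ _ y<d = ⊥-elim (y∉ (∈-between⁺ (<-trans b<x x<y) y<d))
      ... | tri> _ _ y<x = exchange-confines (exchangeable-sym {N = N₁} xy) y<x b∈₂ d∈₂ (∈-between⁺ y<b b<x)
                                             (λ d∈ → <-asym (proj₂ (∈-between⁻ d∈)) x<d)
        where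
        y<b : y <ᶠ b
        y<b with <-cmp y b
        ... | tri< y<b _ _ = y<b
        ... | tri≈ _ y≡b _ = ⊥-elim (apart y∈₁ b∈₂ y≡b)
        ... | tri> _ _ b<y = ⊥-elim (y∉ (∈-between⁺ b<y (<-trans y<x x<d)))

  summand-cyclicInterval : ∀ {n} (M N₁ N₂ : Matroid n) → ground M ≡ ⊤ → IsPositroid F M → IsDirectSum M N₁ N₂ →
                           Connected N₁ → Connected N₂ → Nonempty (ground N₁) → Nonempty (ground N₂) → CyclicInterval (ground N₁)
  summand-cyclicInterval M N₁ N₂ ground≡⊤ positroid sum connected₁ connected₂ nonempty₁ nonempty₂ =
    nonalternating⇒cyclicInterval (ground≡⊤⇒covers {M = M} {N₁} {N₂} sum ground≡⊤) (disjoint {M = M} {N₁} {N₂} sum)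
      nonempty₁ nonempty₂
      (Interleaving.no-alternation {M = M} {N₁} {N₂} ground≡⊤ positroid sum connected₁ connected₂)
      (Interleaving.no-alternation {M = M} {N₂} {N₁} ground≡⊤ positroid (isDirectSum-comm {M = M} {N₁} {N₂} sum)
                                   connected₂ connected₁)

proposition7p4 : ∀ {c ℓ} (F : OrderedField c ℓ) (n : ℕ) (M M₁ M₂ : Matroid n) →
    Matroid.ground M ≡ ⊤ → IsPositroid F M →
    IsPositroid F M₁ → IsPositroid F M₂ → Connected M₁ → Connected M₂ →
    Nonempty (Matroid.ground M₁) → Nonempty (Matroid.ground M₂) →
    IsDirectSum M M₁ M₂ →
    CyclicInterval (Matroid.ground M₁) × CyclicInterval (Matroid.ground M₂)
proposition7p4 F n M M₁ M₂ ground≡⊤ positroid _ _ connected₁ connected₂ nonempty₁ nonempty₂ sum =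
  summand-cyclicInterval M M₁ M₂ ground≡⊤ positroid sum connected₁ connected₂ nonempty₁ nonempty₂ ,
  summand-cyclicInterval M M₂ M₁ ground≡⊤ positroid (isDirectSum-comm {M = M} {M₁} {M₂} sum)
                         connected₂ connected₁ nonempty₂ nonempty₁
  where open PositroidDirectSums F
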